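{- Let $G$ be a ribbon graph (equivalently, a graph cellularly embedded in a closed surface) with edge set $E(G)$, and let $L_G(x,y,z)$ be its Las Vergnas polynomial. Then \[ L_G(x,y,z) = \sum_{A \subseteq E(G)} (x-1)^{r_G(E(G)) - r_G(A)} (y-1)^{n_G(A) - (\gamma(G)+\gamma_G(A)-\gamma_{G^*}(A^c))/2}\, z^{(\gamma(G)-\gamma_G(A)+\gamma_{G^*}(A^c))/2}, \] where $A^c := E(G)\setminus A$.
   Context: For a graph $H$ and $A\subseteq E(H)$, $v(A)$, $c(A)$ denote the number of vertices and components of the spanning subgraph $(V(H),A)$; $r_H(A)=v(A)-c(A)$ and $n_H(A)=|A|-r_H(A)$. For a ribbon graph $G$ and $A\subseteq E(G)$, $\gamma_G(A)$ is the Euler genus of the spanning ribbon subgraph $(V(G),A)$ (viewed as a surface with boundary), and $\gamma(G)=\gamma_G(E(G))$. $G^*$ is the geometric dual ribbon graph, whose edges are naturally identified with those of $G$; $\gamma_{G^*}(A^c)$ is the Euler genus of the spanning ribbon subgraph of $G^*$ with edge set $A^c$. The Euler genus of a surface is its genus if non-orientable and twice its genus if orientable. A matroid $M=(E,r)$ is given by its rank function; the dual $M^*$ has rank $r^*(A)=|A|+r(E\setminus A)-r(E)$. The cycle matroid $C(H)$ has rank $r_H$, and the bond matroid is $B(H)=C(H)^*$. A matroid perspective $M\to M'$ on a set $E$ is a pair of matroids $M=(E,r)$, $M'=(E,r')$ with $r(B)-r(A)\ge r'(B)-r'(A)$ for all $A\subseteq B\subseteq E$; its Tutte polynomial is $T_{M\to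 M'}(x,y,z)=\sum_{X\subseteq E}(x-1)^{r'(E)-r'(X)}(y-1)^{|X|-r(X)}z^{(r(E)-r(X))-(r'(E)-r'(X))}$. The Las Vergnas polynomial of $G$ is $L_G(x,y,z):=T_{B(G^*)\to C(G)}(x,y,z)$, using the natural identification of the edges of $G$ and $G^*$. -}

module Defs where

open import Level using (Level)
open import Data.Bool using (Bool; true; false; _∨_; _∧_; not; if_then_else_)
open import Data.Nat using (ℕ; zero; suc; _+_; _*_; _∸_; ⌊_/2⌋)
open import Data.Fin using (Fin; zero; suc; remQuot; combine; _≟_; _<?_)
open import Data.Fin.Subset using (Subset; ∣_∣; ∁; ⊤; inside; outside)
open import Data.Vec using (Vec; []; _∷_; lookup)
open import Data.List using (List; []; _∷_; _++_; map; foldr)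
open import Data.Product using (_×_; _,_; proj₁)
open import Relation.Nullary.Decidable using (⌊_⌋)
open import Relation.Binary.PropositionalEquality using (_≡_; _≢_)
open import Algebra.Bundles using (CommutativeRing)

anyF : ∀ {N} → (Fin N → Bool) → Bool
anyF {zero}  f = false
anyF {suc N} f = f zero ∨ anyF (λ i → f (suc i))

countF : ∀ {N} → (Fin N → Bool) → ℕ
countF {zero}  f = 0
countF {suc N} f = (if f zero then 1 else 0) + countF (λ i → f (suc i))

anyL : {A : Set} → (A → Bool) → List A → Bool
anyL p []       = false
anyL p (a ∷ as) = p a ∨ anyL p as

reach : ∀ {N} → (Fin N → Fin N → Bool) → ℕ → Fin N → Fin N → Bool
reach adj zero    i j = ⌊ i ≟ j ⌋
reach adj (suc k) i j = reach adj k i j ∨ anyF (λ m → reach adj k i m ∧ adj m j)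

-- number of connected components of a symmetric relation on Fin N
-- (= number of elements that are the least element of their class)
components : ∀ N → (Fin N → Fin N → Bool) → ℕ
components N adj =
  countF (λ i → not (anyF (λ j → reach adj N i j ∧ ⌊ j <? i ⌋)))

-- Ribbon graphs as graph-encoded maps (GEMs).
-- Each edge e carries four flags (e , l), l : Fin 4, where
--   l = 0 : end a, side 1     l = 1 : end a, side 2
--   l = 2 : end b, side 1     l = 3 : end b, side 2.
-- τ0 moves to the other end of the edge (same side), τ2 switches side
-- (same end); these are fixed.  τ1 (the only datum) pairs flags across
-- the corners around vertices.  Vertices = ⟨τ1,τ2⟩-orbits, edges =
-- ⟨τ0,τ2⟩-orbits, faces (boundary components) = ⟨τ0,τ1⟩-orbits.
-- Vertices with no incident edge cannot be encoded by flags and are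
-- recorded separately (nIso).

Flag : ℕ → Set
Flag n = Fin n × Fin 4

τ0L τ2L πL : Fin 4 → Fin 4
τ0L zero = suc (suc zero)
τ0L (suc zero) = suc (suc (suc zero))
τ0L (suc (suc zero)) = zero
τ0L (suc (suc (suc zero))) = suc zero
τ2L zero = suc zero
τ2L (suc zero) = zero
τ2L (suc (suc zero)) = suc (suc (suc zero))
τ2L (suc (suc (suc zero))) = suc (suc zero)
-- relabelling exchanging the roles of τ0 and τ2 (used for duality)
πL zero = zero
πL (suc zero) = suc (suc zero)
πL (suc (suc zero)) = suc zero
πL (suc (suc (suc zero))) = suc (suc (suc zero))

τ0 τ2 πF : ∀ {n} → Flag n → Flag n
τ0 (e , l) = e , τ0L l
τ2 (e , l) = e , τ2L l
πF (e , l) = e , πL l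

record RibbonGraph : Set where
  field
    nIso  : ℕ
    nE    : ℕ
    τ1    : Flag nE → Flag nE
    τ1-invol : ∀ f → τ1 (τ1 f) ≡ f
    τ1-fpf   : ∀ f → τ1 f ≢ f

open RibbonGraph public

-- number of orbits of the group generated by a list of involutions
orbits : ∀ n → List (Flag n → Flag n) → ℕ
orbits n gens = components (n * 4) adj
  where
  enc : Flag n → Fin (n * 4)
  enc (e , l) = combine e l
  adj : Fin (n * 4) → Fin (n * 4) → Bool
  adj i j = anyL (λ σ → ⌊ enc (σ (remQuot 4 i)) ≟ j ⌋) gens

module _ (G : RibbonGraph) where
  private n = nE G

  Edges : Set
  Edges = Subset n

  τ0-in : Edges → Flag n → Flag n
  τ0-in A (e , l) = if lookup A e then τ0 (e , l) else (e , l)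

  -- face permutation partner of the spanning ribbon subgraph (V(G),A):
  -- along edges of A cross the edge, at deleted edges just pass by
  τ0-sub : Edges → Flag n → Flag n
  τ0-sub A (e , l) = if lookup A e then τ0 (e , l) else τ2 (e , l)

  nVert : ℕ
  nVert = orbits n (τ1 G ∷ τ2 ∷ []) + nIso G

  comps : Edges → ℕ
  comps A = orbits n (τ1 G ∷ τ2 ∷ τ0-in A ∷ []) + nIso G

  bdry : Edges → ℕ
  bdry A = orbits n (τ1 G ∷ τ0-sub A ∷ []) + nIso G

  rk : Edges → ℕ
  rk A = nVert ∸ comps A

  nul : Edges → ℕ
  nul A = ∣ A ∣ ∸ rk A

  eg : Edges → ℕ
  eg A = (2 * comps A + ∣ A ∣) ∸ (nVert + bdry A)

  γ : ℕ
  γ = eg ⊤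

-- geometric dual: exchange the roles of τ0 and τ2 (relabel by πF);
-- edges of G and G* are identified (same Fin nE).
πL-invol : ∀ l → πL (πL l) ≡ l
πL-invol zero = _≡_.refl
πL-invol (suc zero) = _≡_.refl
πL-invol (suc (suc zero)) = _≡_.refl
πL-invol (suc (suc (suc zero))) = _≡_.refl

private
  open import Relation.Binary.PropositionalEquality using (refl; cong; sym; trans)
  πF-invol : ∀ {n} (f : Flag n) → πF (πF f) ≡ f
  πF-invol (e , l) = cong (e ,_) (πL-invol l)

dual : RibbonGraph → RibbonGraph
dual G = record
  { nIso = nIso G
  ; nE = nE G
  ; τ1 = λ f → πF (τ1 G (πF f))
  ; τ1-invol = λ f → trans (cong πF (trans (cong (τ1 G) (πF-invol (τ1 G (πF f)))) (τ1-invol G (πF f)))) (πF-invol f)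
  ; τ1-fpf = λ f eq → τ1-fpf G (πF f) (trans (sym (πF-invol (τ1 G (πF f)))) (cong πF eq))
  }

RankFn : ℕ → Set
RankFn n = Subset n → ℕ

dualRank : ∀ {n} → RankFn n → RankFn n
dualRank r A = (∣ A ∣ + r (∁ A)) ∸ r ⊤

cycleRank : (G : RibbonGraph) → RankFn (nE G)
cycleRank G = rk G

bondRank : (G : RibbonGraph) → RankFn (nE G)
bondRank G = dualRank (cycleRank G)

allSubsets : ∀ n → List (Subset n)
allSubsets zero    = [] ∷ []
allSubsets (suc n) = map (inside ∷_) (allSubsets n) ++ map (outside ∷_) (allSubsets n)

module Poly {c ℓ : Level} (R : CommutativeRing c ℓ) where
  open CommutativeRing R using (Carrier; 0#; 1#) renaming (_+_ to _+R_; _*_ to _*R_; _-_ to _-R_)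

  pow : Carrier → ℕ → Carrier
  pow a zero    = 1#
  pow a (suc k) = a *R pow a k

  sumL : List Carrier → Carrier
  sumL = foldr _+R_ 0#

  tuttePersp : ∀ {n} → RankFn n → RankFn n → Carrier → Carrier → Carrier → Carrier
  tuttePersp {n} r r' x y z = sumL (map term (allSubsets n))
    where
    term : Subset n → Carrier
    term X = pow (x -R 1#) (r' ⊤ ∸ r' X)
           *R pow (y -R 1#) (∣ X ∣ ∸ r X)
           *R pow z ((r ⊤ ∸ r X) ∸ (r' ⊤ ∸ r' X))

  lasVergnas : (G : RibbonGraph) → Carrier → Carrier → Carrier → Carrier
  lasVergnas G = tuttePersp (bondRank (dual G)) (cycleRank G)

  rhs33 : (G : RibbonGraph) → Carrier → Carrier → Carrier → Carrier
  rhs33 G x y z = sumL (map term (allSubsets (nE G)))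
    where
    term : Subset (nE G) → Carrier
    term A = pow (x -R 1#) (rk G ⊤ ∸ rk G A)
           *R pow (y -R 1#) (nul G A ∸ ⌊ (γ G + eg G A) ∸ eg (dual G) (∁ A) /2⌋)
           *R pow z ⌊ (γ G + eg (dual G) (∁ A)) ∸ eg G A /2⌋

module Submission where

-- Both sides are sums over the same list of subsets with the same x-exponent,
-- so it suffices to match the y- and z-exponents subset by subset.  All
-- quantities of Defs are truncated differences of orbit counts of flag
-- involutions, so the proof has three layers.
--  * Combinatorics of orbit counts (modules Counting … Bounds): classes of a
--    boolean relation, orbits of involutions on flags, and the effect of
--    adding one edge (components drop by ≤ 1, boundary components rise by ≤ 1,
--    and the Euler genus does not decrease — the bridge case uses an
--    alternating-walk argument).  Induction over subsets one edge at a time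
--    gives v ≤ c(A)+|A|, γ(A) ≥ 0 and γ(A) ≤ γ(G); duality (relabelling flags)
--    identifies vertices, components and boundaries of G* with faces,
--    components and boundaries of G.
--  * Exactness (RankGenus, DualCounts): with these bounds every truncated
--    difference is a genuine one, giving Euler's relation
--    γ(A) + f(A) + 2 r(A) = v + |A| and monotonicity of r and γ.
--  * Arithmetic (Arithmetic.exponent-identities): from these relations for
--    A in G and A^c in G*, both exponent identities follow by linear algebra
--    over ℕ; the halvings are exact because of two doubling identities.

module Counting where

  open import Data.Bool using (Bool; true; false; _∨_; _∧_; not)
  open import Data.Bool.Properties using (∨-zeroʳ)
  open import Data.Nat using (ℕ; zero; suc; _+_; _≤_; z≤n; s≤s)
  open import Data.Nat.Properties using (≤-trans; ≤-reflexive; m≤n⇒m≤1+n; +-suc)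
  open import Data.Fin using (Fin; zero; suc)
  open import Data.Fin.Properties using (suc-injective)
  open import Data.Product using (Σ; _×_; _,_)
  open import Data.Sum using (_⊎_; inj₁; inj₂)
  open import Data.Empty using (⊥-elim)
  open import Relation.Nullary using (Dec; yes; no)
  open import Relation.Nullary.Decidable using (⌊_⌋)
  open import Relation.Binary.PropositionalEquality
  open import Data.List using (List; []; _∷_; length; map; allFin)
  open import Data.List.Properties using (length-map; length-tabulate)
  open import Data.List.Relation.Unary.Any using (here; there)
  open import Data.List.Membership.Propositional using (_∈_; _∉_)
  open import Data.List.Membership.Propositional.Properties using (∈-allFin; ∈-map⁺; ∈-map⁻)
  open import Data.Fin using (_≟_)
  open import Defs using (anyF; countF)

  true≢false : true ≢ false
  true≢false ()

  ∨-true : ∀ a b → a ∨ b ≡ true → a ≡ true ⊎ b ≡ true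
  ∨-true true  b p = inj₁ refl
  ∨-true false b p = inj₂ p

  ∨-trueʳ : ∀ a {b} → b ≡ true → a ∨ b ≡ true
  ∨-trueʳ a refl = ∨-zeroʳ a

  ∧-true : ∀ a b → a ∧ b ≡ true → a ≡ true × b ≡ true
  ∧-true true b p = refl , p

  ∧-intro : ∀ {a b} → a ≡ true → b ≡ true → a ∧ b ≡ true
  ∧-intro refl refl = refl

  not-true : ∀ a → not a ≡ true → a ≡ false
  not-true false p = refl

  not-false : ∀ a → not a ≡ false → a ≡ true
  not-false true p = refl

  ⌊⌋-sound : ∀ {P : Set} (d : Dec P) → ⌊ d ⌋ ≡ true → P
  ⌊⌋-sound (yes p) _ = p

  ⌊⌋-complete : ∀ {P : Set} (d : Dec P) → P → ⌊ d ⌋ ≡ true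
  ⌊⌋-complete (yes _) _ = refl
  ⌊⌋-complete (no ¬p) p = ⊥-elim (¬p p)

  anyF-witness : ∀ {N} (f : Fin N → Bool) → anyF f ≡ true → Σ (Fin N) λ i → f i ≡ true
  anyF-witness {suc N} f p with ∨-true (f zero) _ p
  ... | inj₁ q = zero , q
  ... | inj₂ q with anyF-witness (λ i → f (suc i)) q
  ... | i , r = suc i , r

  anyF-intro : ∀ {N} (f : Fin N → Bool) (i : Fin N) → f i ≡ true → anyF f ≡ true
  anyF-intro f zero    p rewrite p = refl
  anyF-intro f (suc i) p = ∨-trueʳ (f zero) (anyF-intro (λ i → f (suc i)) i p)

  count-mono : ∀ {N} (P Q : Fin N → Bool) → (∀ i → P i ≡ true → Q i ≡ true) → countF P ≤ countF Q
  count-mono {zero} P Q h = z≤n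
  count-mono {suc N} P Q h with P zero in eP | Q zero in eQ
  ... | true  | true  = s≤s (count-mono _ _ (λ i → h (suc i)))
  ... | true  | false with () ← trans (sym (h zero eP)) eQ
  ... | false | true  = m≤n⇒m≤1+n (count-mono _ _ (λ i → h (suc i)))
  ... | false | false = count-mono _ _ (λ i → h (suc i))

  count-strict : ∀ {N} (P Q : Fin N → Bool) → (∀ i → Q i ≡ true → P i ≡ true) → (i₀ : Fin N)
    → P i₀ ≡ true → Q i₀ ≡ false → suc (countF Q) ≤ countF P
  count-strict {suc N} P Q h zero p q rewrite p | q = s≤s (count-mono _ _ (λ i → h (suc i)))
  count-strict {suc N} P Q h (suc i₀) p q with P zero in eP | Q zero in eQ
  ... | true  | true  = s≤s (count-strict _ _ (λ i → h (suc i)) i₀ p q)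
  ... | true  | false = m≤n⇒m≤1+n (count-strict _ _ (λ i → h (suc i)) i₀ p q)
  ... | false | true with () ← trans (sym (h zero eQ)) eP
  ... | false | false = count-strict _ _ (λ i → h (suc i)) i₀ p q

  count-split : ∀ {N} (P Q : Fin N → Bool) → countF P ≤ countF Q + countF (λ i → P i ∧ not (Q i))
  count-split {zero} P Q = z≤n
  count-split {suc N} P Q with P zero | Q zero
  ... | true  | true  = s≤s (count-split (λ i → P (suc i)) (λ i → Q (suc i)))
  ... | true  | false = ≤-trans (s≤s (count-split (λ i → P (suc i)) (λ i → Q (suc i))))
                                (≤-reflexive (sym (+-suc _ _)))
  ... | false | true  = m≤n⇒m≤1+n (count-split (λ i → P (suc i)) (λ i → Q (suc i)))
  ... | false | false = count-split (λ i → P (suc i)) (λ i → Q (suc i))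

  count-zero : ∀ {N} (P : Fin N → Bool) → (∀ i → P i ≡ false) → countF P ≡ 0
  count-zero {zero} P h = refl
  count-zero {suc N} P h rewrite h zero = count-zero (λ i → P (suc i)) (λ i → h (suc i))

  count-≤1 : ∀ {N} (P : Fin N → Bool) → (∀ i j → P i ≡ true → P j ≡ true → i ≡ j) → countF P ≤ 1
  count-≤1 {zero} P h = z≤n
  count-≤1 {suc N} P h with P zero in e
  ... | true  = s≤s (≤-reflexive (count-zero (λ i → P (suc i)) rest))
    where
    rest : ∀ i → P (suc i) ≡ false
    rest i with P (suc i) in e′
    ... | false = refl
    ... | true with () ← h zero (suc i) e e′
  ... | false = count-≤1 (λ i → P (suc i)) (λ i j p q → suc-injective (h (suc i) (suc j) p q))

  module _ {N : ℕ} where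

    data Distinct : List (Fin N) → Set where
      []  : Distinct []
      _∷_ : ∀ {x xs} → x ∉ xs → Distinct xs → Distinct (x ∷ xs)

    delete : Fin N → List (Fin N) → List (Fin N)
    delete x [] = []
    delete x (y ∷ ys) with x ≟ y
    ... | yes _ = ys
    ... | no  _ = y ∷ delete x ys

    delete-length : ∀ x ys → x ∈ ys → length ys ≡ suc (length (delete x ys))
    delete-length x (y ∷ ys) m with x ≟ y
    ... | yes _ = refl
    delete-length x (y ∷ ys) (here refl) | no x≢y = ⊥-elim (x≢y refl)
    delete-length x (y ∷ ys) (there m)   | no _   = cong suc (delete-length x ys m)

    delete-keeps : ∀ x z ys → z ∈ ys → z ≢ x → z ∈ delete x ys
    delete-keeps x z (y ∷ ys) m z≢x with x ≟ y
    delete-keeps x z (y ∷ ys) (here refl) z≢x | yes refl = ⊥-elim (z≢x refl)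
    delete-keeps x z (y ∷ ys) (there m)   z≢x | yes refl = m
    delete-keeps x z (y ∷ ys) (here refl) z≢x | no _     = here refl
    delete-keeps x z (y ∷ ys) (there m)   z≢x | no _     = there (delete-keeps x z ys m z≢x)

    injection-length : (g : Fin N → Fin N) (xs ys : List (Fin N)) → Distinct xs
      → (∀ x → x ∈ xs → g x ∈ ys)
      → (∀ x y → x ∈ xs → y ∈ xs → g x ≡ g y → x ≡ y)
      → length xs ≤ length ys
    injection-length g [] ys _ _ _ = z≤n
    injection-length g (x ∷ xs) ys (x∉xs ∷ d) into inj =
      ≤-trans (s≤s (injection-length g xs (delete (g x) ys) d into′ (λ a b a∈ b∈ → inj a b (there a∈) (there b∈))))
              (≤-reflexive (sym (delete-length (g x) ys (into x (here refl)))))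
      where
      into′ : ∀ y → y ∈ xs → g y ∈ delete (g x) ys
      into′ y y∈ = delete-keeps (g x) (g y) ys (into y (there y∈))
                     (λ e → x∉xs (subst (_∈ xs) (inj y x (there y∈) (here refl) e) y∈))

    distinct-length : (xs : List (Fin N)) → Distinct xs → length xs ≤ N
    distinct-length xs d =
      ≤-trans (injection-length (λ x → x) xs (allFin N) d (λ x _ → ∈-allFin x) (λ x y _ _ e → e))
              (≤-reflexive (length-tabulate (λ x → x)))

  elements : ∀ {N} → (Fin N → Bool) → List (Fin N)
  elements {zero}  P = []
  elements {suc N} P with P zero
  ... | true  = zero ∷ map suc (elements (λ i → P (suc i)))
  ... | false = map suc (elements (λ i → P (suc i)))

  elements-length : ∀ {N} (P : Fin N → Bool) → length (elements P) ≡ countF P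
  elements-length {zero} P = refl
  elements-length {suc N} P with P zero
  ... | true  = cong suc (trans (length-map suc (elements (λ i → P (suc i)))) (elements-length (λ i → P (suc i))))
  ... | false = trans (length-map suc (elements (λ i → P (suc i)))) (elements-length (λ i → P (suc i)))

  elements-sound : ∀ {N} (P : Fin N → Bool) x → x ∈ elements P → P x ≡ true
  elements-sound {suc N} P x m with P zero in e
  elements-sound {suc N} P x (here refl) | true = e
  elements-sound {suc N} P x (there m)   | true with ∈-map⁻ suc m
  ... | y , y∈ , refl = elements-sound (λ i → P (suc i)) y y∈
  elements-sound {suc N} P x m | false with ∈-map⁻ suc m
  ... | y , y∈ , refl = elements-sound (λ i → P (suc i)) y y∈

  elements-complete : ∀ {N} (P : Fin N → Bool) x → P x ≡ true → x ∈ elements P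
  elements-complete {suc N} P zero p rewrite p = here refl
  elements-complete {suc N} P (suc x) p with P zero
  ... | true  = there (∈-map⁺ suc (elements-complete (λ i → P (suc i)) x p))
  ... | false = ∈-map⁺ suc (elements-complete (λ i → P (suc i)) x p)

  distinct-map-suc : ∀ {N} (xs : List (Fin N)) → Distinct xs → Distinct (map suc xs)
  distinct-map-suc [] [] = []
  distinct-map-suc (x ∷ xs) (x∉xs ∷ d) = (λ m → x∉xs (unsuc m)) ∷ distinct-map-suc xs d
    where
    unsuc : suc x ∈ map suc xs → x ∈ xs
    unsuc m with ∈-map⁻ suc m
    ... | y , y∈ , e = subst (_∈ xs) (sym (suc-injective e)) y∈

  elements-distinct : ∀ {N} (P : Fin N → Bool) → Distinct (elements P)
  elements-distinct {zero} P = []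
  elements-distinct {suc N} P with P zero
  ... | true  = zero∉ ∷ distinct-map-suc _ (elements-distinct (λ i → P (suc i)))
    where
    zero∉ : zero ∉ map suc (elements (λ i → P (suc i)))
    zero∉ m with ∈-map⁻ suc m
    ... | _ , _ , ()
  ... | false = distinct-map-suc _ (elements-distinct (λ i → P (suc i)))

  count-injection : ∀ {N} (P Q : Fin N → Bool) (g : Fin N → Fin N)
    → (∀ i → P i ≡ true → Q (g i) ≡ true)
    → (∀ i j → P i ≡ true → P j ≡ true → g i ≡ g j → i ≡ j)
    → countF P ≤ countF Q
  count-injection P Q g into inj =
    subst₂ _≤_ (elements-length P) (elements-length Q)
      (injection-length g (elements P) (elements Q) (elements-distinct P)
        (λ x m → elements-complete Q (g x) (into x (elements-sound P x m)))
        (λ x y mx my → inj x y (elements-sound P x mx) (elements-sound P y my)))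

module Classes where

  open import Data.Bool using (Bool; true; false; _∧_; not)
  open import Data.Nat using (ℕ; zero; suc; _+_; _≤_; _<_; z≤n; s≤s)
  open import Data.Nat.Properties using (≤-refl; ≤-trans; ≤-pred; n≤1+n; <-asym; ≤-<-trans; ≮⇒≥; +-monoʳ-≤)
  open import Data.Fin using (Fin; zero; suc; _≟_; _<?_; toℕ) renaming (_<_ to _<ᶠ_)
  open import Data.Fin.Properties using (<-cmp)
  open import Data.Product using (Σ; _×_; _,_; proj₁; proj₂)
  open import Data.Sum using (_⊎_; inj₁; inj₂)
  open import Data.Empty using (⊥; ⊥-elim)
  open import Relation.Binary using (tri<; tri≈; tri>)
  open import Relation.Nullary using (¬_; yes; no)
  open import Relation.Nullary.Decidable using (⌊_⌋)
  open import Relation.Binary.PropositionalEquality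
  open import Data.List using (List; []; _∷_; length; _++_)
  open import Data.List.Relation.Unary.Any using (here; there)
  open import Data.List.Membership.Propositional using (_∈_)
  open import Defs using (anyF; countF; reach; components)
  open Counting

  module Connectivity {N : ℕ} (adj : Fin N → Fin N → Bool) where
    open import Data.List.Membership.DecPropositional (_≟_ {N}) using (_∈?_)

    data Path (i : Fin N) : Fin N → Set where
      []  : Path i i
      _▷_ : ∀ {m j} → Path i m → adj m j ≡ true → Path i j

    steps : ∀ {i j} → Path i j → ℕ
    steps []      = 0
    steps (p ▷ _) = suc (steps p)

    visited : ∀ {i j} → Path i j → List (Fin N)
    visited {i} []        = i ∷ []
    visited {j = j} (p ▷ _) = j ∷ visited p

    visited-length : ∀ {i j} (p : Path i j) → length (visited p) ≡ suc (steps p)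
    visited-length []      = refl
    visited-length (p ▷ _) = cong suc (visited-length p)

    reach-path : ∀ k i j → reach adj k i j ≡ true → Path i j
    reach-path zero i j p = subst (Path i) (⌊⌋-sound (i ≟ j) p) []
    reach-path (suc k) i j p with ∨-true (reach adj k i j) _ p
    ... | inj₁ q = reach-path k i j q
    ... | inj₂ q with anyF-witness _ q
    ... | m , r with ∧-true (reach adj k i m) (adj m j) r
    ... | r₁ , r₂ = reach-path k i m r₁ ▷ r₂

    path-reach : ∀ k {i j} (p : Path i j) → steps p ≤ k → reach adj k i j ≡ true
    path-reach zero    {i} [] _ = ⌊⌋-complete (i ≟ i) refl
    path-reach (suc k) {i} [] _ rewrite path-reach k {i} [] z≤n = refl
    path-reach (suc k) {i} (_▷_ {m} p e) (s≤s l) =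
      ∨-trueʳ (reach adj k i _) (anyF-intro _ m (∧-intro (path-reach k p l) e))

    cut : ∀ {i m x} (p : Path i m) → x ∈ visited p
      → Σ (Path i x) λ r → Σ (List (Fin N)) λ ys → visited p ≡ ys ++ visited r
    cut []      (here refl) = [] , [] , refl
    cut (p ▷ e) (here refl) = (p ▷ e) , [] , refl
    cut {m = m} (p ▷ e) (there x∈) with cut p x∈
    ... | r , ys , eq = r , m ∷ ys , cong (m ∷_) eq

    distinct-suffix : ∀ (ys : List (Fin N)) {zs} → Distinct (ys ++ zs) → Distinct zs
    distinct-suffix []       d       = d
    distinct-suffix (y ∷ ys) (_ ∷ d) = distinct-suffix ys d

    shorten : ∀ {i j} → Path i j → Σ (Path i j) λ q → Distinct (visited q)
    shorten [] = [] , ((λ ()) ∷ [])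
    shorten {j = j} (p ▷ e) with shorten p
    ... | q , dq with j ∈? visited q
    ... | yes j∈ with cut q j∈
    ... | r , ys , eq = r , distinct-suffix ys (subst Distinct eq dq)
    shorten {j = j} (p ▷ e) | q , dq | no j∉ = (q ▷ e) , (j∉ ∷ dq)

    -- i and j lie in the same class; N steps always suffice.
    conn : Fin N → Fin N → Set
    conn i j = reach adj N i j ≡ true

    conn-path : ∀ {i j} → conn i j → Path i j
    conn-path {i} {j} c = reach-path N i j c

    path-conn : ∀ {i j} → Path i j → conn i j
    path-conn p with shorten p
    ... | q , dq = path-reach N q
          (≤-trans (n≤1+n _) (subst (_≤ N) (visited-length q) (distinct-length (visited q) dq)))

    _++ₚ_ : ∀ {i m j} → Path i m → Path m j → Path i j
    p ++ₚ []      = p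
    p ++ₚ (q ▷ e) = (p ++ₚ q) ▷ e

    conn-refl : ∀ i → conn i i
    conn-refl i = path-conn []

    conn-trans : ∀ {i j k} → conn i j → conn j k → conn i k
    conn-trans c d = path-conn (conn-path c ++ₚ conn-path d)

    edge-conn : ∀ {i j} → adj i j ≡ true → conn i j
    edge-conn e = path-conn ([] ▷ e)

    isRep : Fin N → Bool
    isRep i = not (anyF (λ j → reach adj N i j ∧ ⌊ j <? i ⌋))

    rep-minimal : ∀ {i} → isRep i ≡ true → ∀ j → conn i j → ¬ (j <ᶠ i)
    rep-minimal {i} r j c j<i with () ← trans (sym (anyF-intro _ j (∧-intro c (⌊⌋-complete (j <? i) j<i)))) (not-true _ r)

    minimal-rep : ∀ {i} → (∀ j → conn i j → ¬ (j <ᶠ i)) → isRep i ≡ true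
    minimal-rep {i} h with anyF (λ j → reach adj N i j ∧ ⌊ j <? i ⌋) in e
    ... | false = refl
    ... | true with anyF-witness _ e
    ... | j , q with ∧-true (reach adj N i j) _ q
    ... | c , lt = ⊥-elim (h j c (⌊⌋-sound (j <? i) lt))

    nonrep-smaller : ∀ {i} → isRep i ≡ false → Σ (Fin N) λ j → conn i j × (j <ᶠ i)
    nonrep-smaller {i} r with anyF-witness _ (not-false _ r)
    ... | j , q with ∧-true (reach adj N i j) _ q
    ... | c , lt = j , c , ⌊⌋-sound (j <? i) lt

    -- Every element reaches a representative (descend along smaller elements).
    rep-of : ∀ i → Σ (Fin N) λ r → isRep r ≡ true × conn i r
    rep-of i = descend (suc (toℕ i)) i ≤-refl
      where
      descend : ∀ k i → toℕ i < k → Σ (Fin N) λ r → isRep r ≡ true × conn i r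
      descend (suc k) i lt with isRep i in e
      ... | true = i , e , conn-refl i
      ... | false with nonrep-smaller e
      ... | j , c , j<i with descend k j (≤-trans j<i (≤-pred lt))
      ... | r , rr , c′ = r , rr , conn-trans c c′

    module Symmetric (adj-sym : ∀ i j → adj i j ≡ true → adj j i ≡ true) where
      consₚ : ∀ {i m j} → adj i m ≡ true → Path m j → Path i j
      consₚ e []       = [] ▷ e
      consₚ e (p ▷ e′) = consₚ e p ▷ e′

      reverse : ∀ {i j} → Path i j → Path j i
      reverse []      = []
      reverse (p ▷ e) = consₚ (adj-sym _ _ e) (reverse p)

      conn-sym : ∀ {i j} → conn i j → conn j i
      conn-sym c = path-conn (reverse (conn-path c))

      rep-unique : ∀ {i j} → isRep i ≡ true → isRep j ≡ true → conn i j → i ≡ j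
      rep-unique {i} {j} ri rj c with <-cmp i j
      ... | tri< lt _ _ = ⊥-elim (rep-minimal rj i (conn-sym c) lt)
      ... | tri≈ _ eq _ = eq
      ... | tri> _ _ gt = ⊥-elim (rep-minimal ri j c gt)

  transport : ∀ {N} (adj₁ adj₂ : Fin N → Fin N → Bool) (φ : Fin N → Fin N)
    → (∀ i j → adj₁ i j ≡ true → Connectivity.conn adj₂ (φ i) (φ j))
    → ∀ {i j} → Connectivity.conn adj₁ i j → Connectivity.conn adj₂ (φ i) (φ j)
  transport adj₁ adj₂ φ h c = along (C₁.conn-path c)
    where
    module C₁ = Connectivity adj₁
    module C₂ = Connectivity adj₂
    along : ∀ {i j} → C₁.Path i j → C₂.conn (φ i) (φ j)
    along {i} C₁.[] = C₂.conn-refl (φ i)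
    along (p C₁.▷ e) = C₂.conn-trans (along p) (h _ _ e)

  module Compare {N : ℕ} (adj₁ adj₂ : Fin N → Fin N → Bool)
    (sym₁ : ∀ i j → adj₁ i j ≡ true → adj₁ j i ≡ true)
    (sym₂ : ∀ i j → adj₂ i j ≡ true → adj₂ j i ≡ true) where
    module A = Connectivity adj₁
    module B = Connectivity adj₂
    module AS = A.Symmetric sym₁
    module BS = B.Symmetric sym₂

    -- If φ reflects connectivity (A-connected images come from B-connected
    -- points), B has at least as many classes as A: send each B-representative
    -- to the A-representative of its image.
    fewer-classes : (φ : Fin N → Fin N) → (∀ i j → A.conn (φ i) (φ j) → B.conn i j)
      → components N adj₂ ≤ components N adj₁
    fewer-classes φ reflect = count-injection B.isRep A.isRep rep (λ i _ → proj₁ (proj₂ (A.rep-of (φ i)))) injective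
      where
      rep : Fin N → Fin N
      rep i = proj₁ (A.rep-of (φ i))
      injective : ∀ i j → B.isRep i ≡ true → B.isRep j ≡ true → rep i ≡ rep j → i ≡ j
      injective i j ri rj e =
        BS.rep-unique ri rj (reflect i j (A.conn-trans (proj₂ (proj₂ (A.rep-of (φ i))))
          (subst (λ r → A.conn r (φ j)) (sym e) (AS.conn-sym (proj₂ (proj₂ (A.rep-of (φ j))))))))

    module Coarser (coarser : ∀ i j → A.conn i j → B.conn i j) where
      rep-rep : ∀ i → B.isRep i ≡ true → A.isRep i ≡ true
      rep-rep i r = A.minimal-rep (λ j c → B.rep-minimal r j (coarser _ _ c))

      not-rep : ∀ i j → B.conn i j → j <ᶠ i → B.isRep i ≡ false
      not-rep i j c lt with B.isRep i in e
      ... | false = refl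
      ... | true  = ⊥-elim (B.rep-minimal e j c lt)

      merge : ∀ a b → B.conn a b → ¬ A.conn a b → suc (components N adj₂) ≤ components N adj₁
      merge a b cab ¬cab with A.rep-of a | A.rep-of b
      ... | ra , rra , ca | rb , rrb , cb with <-cmp ra rb
      ... | tri≈ _ eq _ = ⊥-elim (¬cab (A.conn-trans ca (subst (λ z → A.conn z b) (sym eq) (AS.conn-sym cb))))
      ... | tri< lt _ _ = count-strict A.isRep B.isRep rep-rep rb rrb
            (not-rep rb ra (B.conn-trans (BS.conn-sym (coarser _ _ cb)) (B.conn-trans (BS.conn-sym cab) (coarser _ _ ca))) lt)
      ... | tri> _ _ gt = count-strict A.isRep B.isRep rep-rep ra rra
            (not-rep ra rb (B.conn-trans (BS.conn-sym (coarser _ _ ca)) (B.conn-trans cab (coarser _ _ cb))) gt)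

    module AddEdge (a b : Fin N) where
      private
        _~_ : Fin N → Fin N → Set
        _~_ = A.conn
        s : ∀ {i j} → i ~ j → j ~ i
        s = AS.conn-sym
        t : ∀ {i j k} → i ~ j → j ~ k → i ~ k
        t = A.conn-trans

      -- connected in A, possibly using the new edge once
      Joined : Fin N → Fin N → Set
      Joined i j = (i ~ j) ⊎ ((i ~ a) × (j ~ b)) ⊎ ((i ~ b) × (j ~ a))

      joined-trans : ∀ {i m j} → Joined i m → Joined m j → Joined i j
      joined-trans (inj₁ x) (inj₁ y) = inj₁ (t x y)
      joined-trans (inj₁ x) (inj₂ (inj₁ (y , z))) = inj₂ (inj₁ (t x y , z))
      joined-trans (inj₁ x) (inj₂ (inj₂ (y , z))) = inj₂ (inj₂ (t x y , z))
      joined-trans (inj₂ (inj₁ (x , y))) (inj₁ z) = inj₂ (inj₁ (x , t (s z) y))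
      joined-trans (inj₂ (inj₁ (x , y))) (inj₂ (inj₁ (z , w))) = inj₁ (t x (t (s z) (t y (s w))))
      joined-trans (inj₂ (inj₁ (x , y))) (inj₂ (inj₂ (z , w))) = inj₁ (t x (s w))
      joined-trans (inj₂ (inj₂ (x , y))) (inj₁ z) = inj₂ (inj₂ (x , t (s z) y))
      joined-trans (inj₂ (inj₂ (x , y))) (inj₂ (inj₁ (z , w))) = inj₁ (t x (s w))
      joined-trans (inj₂ (inj₂ (x , y))) (inj₂ (inj₂ (z , w))) = inj₁ (t x (t (s z) (t y (s w))))

      module _ (edges : ∀ i j → adj₂ i j ≡ true → Joined i j) where
        joined : ∀ {i j} → B.conn i j → Joined i j
        joined {i} c = along (B.conn-path c)
          where
          along : ∀ {j} → B.Path i j → Joined i j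
          along B.[] = inj₁ (A.conn-refl i)
          along (p B.▷ e) = joined-trans (along p) (edges _ _ e)

        -- An A-representative that is no B-representative has a smaller
        -- element across the new edge; two such would cross each other.
        at-most-one-more : components N adj₁ ≤ components N adj₂ + 1
        at-most-one-more = ≤-trans (count-split A.isRep B.isRep) (+-monoʳ-≤ (countF B.isRep) (count-≤1 Lost unique))
          where
          Lost : Fin N → Bool
          Lost i = A.isRep i ∧ not (B.isRep i)
          Across : Fin N → Set
          Across i = Σ (Fin N) λ j → (j <ᶠ i) × (((i ~ a) × (j ~ b)) ⊎ ((i ~ b) × (j ~ a)))
          lost : ∀ i → Lost i ≡ true → A.isRep i ≡ true × Across i
          lost i p with ∧-true (A.isRep i) _ p
          ... | ri , nb with B.nonrep-smaller (not-true _ nb)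
          ... | j , c , lt with joined c
          ... | inj₁ x = ⊥-elim (A.rep-minimal ri j x lt)
          ... | inj₂ y = ri , j , lt , y
          cross : ∀ {a′ b′ i j i′ j′} → A.isRep i ≡ true → A.isRep i′ ≡ true
            → i ~ a′ → j ~ b′ → j <ᶠ i → i′ ~ b′ → j′ ~ a′ → j′ <ᶠ i′ → ⊥
          cross {i = i} {j} {i′} {j′} ri ri′ ia jb ji ib ja ji′ =
            <-asym (≤-<-trans (≮⇒≥ (A.rep-minimal ri′ j (t ib (s jb)))) ji)
                   (≤-<-trans (≮⇒≥ (A.rep-minimal ri j′ (t ia (s ja)))) ji′)
          unique : ∀ i i′ → Lost i ≡ true → Lost i′ ≡ true → i ≡ i′
          unique i i′ p p′ with lost i p | lost i′ p′
          ... | ri , j , lt , inj₁ (ia , jb) | ri′ , j′ , lt′ , inj₁ (ia′ , _) = AS.rep-unique ri ri′ (t ia (s ia′))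
          ... | ri , j , lt , inj₂ (ib , ja) | ri′ , j′ , lt′ , inj₂ (ib′ , _) = AS.rep-unique ri ri′ (t ib (s ib′))
          ... | ri , j , lt , inj₁ (ia , jb) | ri′ , j′ , lt′ , inj₂ (ib′ , ja′) = ⊥-elim (cross ri ri′ ia jb lt ib′ ja′ lt′)
          ... | ri , j , lt , inj₂ (ib , ja) | ri′ , j′ , lt′ , inj₁ (ia′ , jb′) = ⊥-elim (cross ri ri′ ib ja lt ia′ jb′ lt′)

-- Alternating walks of two fixed-point-free involutions (used for bridges).
module Walks where

  open import Data.Bool using (Bool; true; false; not; _∨_; if_then_else_)
  open import Data.Bool.Properties using (∨-zeroʳ)
  open import Data.Nat using (ℕ; zero; suc; _+_; _∸_; _≤_; _<_; z≤n; s≤s)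
  open import Data.Nat.Properties
    using (≤-refl; ≤-trans; ≤-pred; n≤1+n; n<1+n; m≤n⇒m≤1+n; m≤n⇒m<n∨m≡n; m≤m+n; +-suc;
           m∸n+n≡m; m+n∸m≡n; m≤n⇒∃[o]m+o≡n)
  open import Data.Fin using (Fin; toℕ; _≟_)
  open import Data.Fin.Properties using (pigeonhole)
  open import Data.Product using (Σ; _×_; _,_)
  open import Data.Sum using (_⊎_; inj₁; inj₂)
  open import Data.Empty using (⊥; ⊥-elim)
  open import Relation.Nullary.Decidable using (⌊_⌋)
  open import Relation.Binary.PropositionalEquality
  open Counting using (true≢false; ∨-true; ⌊⌋-sound; ⌊⌋-complete)

  isEven : ℕ → Bool
  isEven zero    = true
  isEven (suc n) = not (isEven n)

  not-not : ∀ b → not (not b) ≡ b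
  not-not true  = refl
  not-not false = refl

  even-double : ∀ i → isEven (i + i) ≡ true
  even-double zero = refl
  even-double (suc i) rewrite +-suc i i = trans (not-not (isEven (i + i))) (even-double i)

  even-half : ∀ t → isEven t ≡ true → Σ ℕ λ h → t ≡ h + h
  even-half zero _ = 0 , refl
  even-half (suc (suc t)) e with even-half t (trans (sym (not-not (isEven t))) e)
  ... | h , refl = suc h , cong suc (sym (+-suc h h))

  even-+ : ∀ a b → isEven (a + b) ≡ (if isEven a then isEven b else not (isEven b))
  even-+ zero b = refl
  even-+ (suc a) b rewrite even-+ a b with isEven a
  ... | true  = refl
  ... | false = not-not (isEven b)

  even-sum : ∀ a b → isEven (a + b) ≡ true → isEven a ≡ isEven b
  even-sum a b e rewrite even-+ a b with isEven a | isEven b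
  ... | true  | true  = refl
  ... | false | false = refl
  even-sum a b () | true  | false
  even-sum a b () | false | true

  suc-∸ : ∀ m n → n ≤ m → suc m ∸ n ≡ suc (m ∸ n)
  suc-∸ m       zero    _       = refl
  suc-∸ (suc m) (suc n) (s≤s p) = suc-∸ m n p

  least-below : (H : ℕ → Bool) → ∀ m
    → (Σ ℕ λ t → H t ≡ true × t ≤ m × (∀ s → s < t → H s ≡ false)) ⊎ (∀ s → s ≤ m → H s ≡ false)
  least-below H zero with H zero in e
  ... | true  = inj₁ (0 , e , z≤n , λ s ())
  ... | false = inj₂ λ { zero _ → e }
  least-below H (suc m) with least-below H m
  ... | inj₁ (t , h , le , least) = inj₁ (t , h , m≤n⇒m≤1+n le , least)
  ... | inj₂ none with H (suc m) in e
  ... | true  = inj₁ (suc m , e , ≤-refl , λ s lt → none s (≤-pred lt))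
  ... | false = inj₂ below
    where
    below : ∀ s → s ≤ suc m → H s ≡ false
    below s le with m≤n⇒m<n∨m≡n le
    ... | inj₁ lt   = none s (≤-pred lt)
    ... | inj₂ refl = e

  -- The alternating walk x, αx, βαx, αβαx, … of two fixed-point-free
  -- involutions on a finite set reaches βx before it meets x or βx again.
  -- (The walk runs around the ⟨α,β⟩-orbit of x, which is a cycle through x
  -- and βx; returning to x first would force a step fixing a point.)
  module AlternatingWalk {M : ℕ} (α β : Fin M → Fin M)
    (α-invol : ∀ y → α (α y) ≡ y) (β-invol : ∀ y → β (β y) ≡ y)
    (α-fpf : ∀ y → α y ≢ y) (β-fpf : ∀ y → β y ≢ y) (x : Fin M) where

    step : ℕ → Fin M → Fin M
    step s = if isEven s then α else β

    step-parity : ∀ a b y → isEven a ≡ isEven b → step a y ≡ step b y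
    step-parity a b y e = cong (λ c → (if c then α else β) y) e

    step-invol : ∀ s y → step s (step s y) ≡ y
    step-invol s y with isEven s
    ... | true  = α-invol y
    ... | false = β-invol y

    step-fpf : ∀ s y → step s y ≢ y
    step-fpf s y with isEven s
    ... | true  = α-fpf y
    ... | false = β-fpf y

    step-even : ∀ s y → isEven s ≡ true → step s y ≡ α y
    step-even s y e = cong (λ c → (if c then α else β) y) e

    step-odd : ∀ s y → isEven s ≡ false → step s y ≡ β y
    step-odd s y e = cong (λ c → (if c then α else β) y) e

    walk : ℕ → Fin M
    walk zero    = x
    walk (suc s) = step s (walk s)

    ρ : Fin M → Fin M
    ρ y = β (α y)

    ρ^ : ℕ → Fin M → Fin M
    ρ^ zero    y = y
    ρ^ (suc i) y = ρ (ρ^ i y)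

    walk-even : ∀ i → walk (i + i) ≡ ρ^ i x
    walk-even zero = refl
    walk-even (suc i) = begin
        walk (suc i + suc i)                          ≡⟨ cong walk (cong suc (+-suc i i)) ⟩
        step (suc (i + i)) (step (i + i) (walk (i + i))) ≡⟨ step-odd (suc (i + i)) _ (cong not (even-double i)) ⟩
        β (step (i + i) (walk (i + i)))               ≡⟨ cong β (step-even (i + i) _ (even-double i)) ⟩
        ρ (walk (i + i))                              ≡⟨ cong ρ (walk-even i) ⟩
        ρ^ (suc i) x                                  ∎
      where open ≡-Reasoning

    ρ^-+ : ∀ a b y → ρ^ (a + b) y ≡ ρ^ a (ρ^ b y)
    ρ^-+ zero    b y = refl
    ρ^-+ (suc a) b y = cong ρ (ρ^-+ a b y)

    ρ-injective : ∀ {y z} → ρ y ≡ ρ z → y ≡ z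
    ρ-injective {y} {z} e = trans (sym (trans (cong α (β-invol (α y))) (α-invol y)))
                               (trans (cong (λ w → α (β w)) e) (trans (cong α (β-invol (α z))) (α-invol z)))

    ρ^-injective : ∀ a {y z} → ρ^ a y ≡ ρ^ a z → y ≡ z
    ρ^-injective zero    e = e
    ρ^-injective (suc a) e = ρ^-injective a (ρ-injective e)

    -- By the pigeonhole principle the walk returns to x at some even time.
    returns : Σ ℕ λ m → walk (suc m + suc m) ≡ x
    returns with pigeonhole (n<1+n M) (λ s → ρ^ (toℕ s) x)
    ... | i , j , i<j , e with m≤n⇒∃[o]m+o≡n i<j
    ... | d , eq = d , trans (walk-even (suc d)) (sym (ρ^-injective (toℕ i) (trans e
          (trans (cong (λ k → ρ^ k x) (trans (sym eq) (sym (+-suc (toℕ i) d)))) (ρ^-+ (toℕ i) (suc d) x)))))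

    hits : ℕ → Bool
    hits zero    = false
    hits (suc s) = ⌊ walk (suc s) ≟ x ⌋ ∨ ⌊ walk (suc s) ≟ β x ⌋

    hits-x : ∀ s → walk (suc s) ≡ x → hits (suc s) ≡ true
    hits-x s e rewrite e | ⌊⌋-complete (x ≟ x) refl = refl

    hits-βx : ∀ s → walk (suc s) ≡ β x → hits (suc s) ≡ true
    hits-βx s e rewrite e | ⌊⌋-complete (β x ≟ β x) refl = ∨-zeroʳ _

    misses : ∀ s → hits (suc s) ≡ false → (walk (suc s) ≢ x) × (walk (suc s) ≢ β x)
    misses s h = (λ e → true≢false (trans (sym (hits-x s e)) h)) , (λ e → true≢false (trans (sym (hits-βx s e)) h))

    reflect : ∀ h → walk (suc (h + h)) ≡ x → ∀ s → s ≤ suc (h + h) → walk (suc (h + h) ∸ s) ≡ walk s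
    reflect h e zero _ = e
    reflect h e (suc s) le = begin
        walk r                 ≡⟨ sym (step-invol r (walk r)) ⟩
        step r (walk (suc r))  ≡⟨ cong (step r) previous ⟩
        step r (walk s)        ≡⟨ step-parity r s (walk s) same-parity ⟩
        walk (suc s)           ∎
      where
      open ≡-Reasoning
      r : ℕ
      r = (h + h) ∸ s
      s≤ : s ≤ h + h
      s≤ = ≤-pred le
      previous : walk (suc r) ≡ walk s
      previous = trans (cong walk (sym (suc-∸ (h + h) s s≤))) (reflect h e s (m≤n⇒m≤1+n s≤))
      same-parity : isEven r ≡ isEven s
      same-parity = even-sum r s (trans (cong isEven (m∸n+n≡m s≤)) (even-double h))

    -- The first time the walk meets {x, βx} it is at βx.  (Abstract: the
    -- witness is never meant to be computed.)
    abstract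
     reaches-βx : Σ ℕ λ t → walk (suc t) ≡ β x × (∀ s → s < t → (walk (suc s) ≢ x) × (walk (suc s) ≢ β x))
     reaches-βx with returns
     ... | m , back with least-below hits (suc m + suc m)
     ... | inj₂ none with () ← trans (sym (hits-x (m + suc m) back)) (none _ ≤-refl)
     ... | inj₁ (zero , () , _)
     ... | inj₁ (suc t , hit , _ , least) with ∨-true ⌊ walk (suc t) ≟ x ⌋ _ hit
     ... | inj₂ at-βx = t , ⌊⌋-sound (walk (suc t) ≟ β x) at-βx , λ s lt → misses s (least (suc s) (s≤s lt))
     ... | inj₁ at-x  = ⊥-elim (not-back-first t (isEven t) refl (⌊⌋-sound (walk (suc t) ≟ x) at-x) least)
       where
       -- at odd time t+1 the previous point was βx, hit earlier
       odd-return : ∀ t → isEven t ≡ false → walk (suc t) ≡ x → (∀ s → s < suc t → hits s ≡ false) → ⊥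
       odd-return (suc t′) odd back′ least′ = true≢false (trans (sym (hits-βx t′ previous)) (least′ (suc t′) ≤-refl))
         where
         previous : walk (suc t′) ≡ β x
         previous = trans (sym (step-invol (suc t′) (walk (suc t′))))
                      (trans (cong (step (suc t′)) back′) (step-odd (suc t′) x odd))
       -- at even time, reflection makes the middle step a fixed point
       middle : ∀ h → suc (h + h) ∸ h ≡ suc h
       middle h = trans (suc-∸ (h + h) h (m≤m+n h h)) (cong suc (m+n∸m≡n h h))
       even-return : ∀ h → walk (suc (h + h)) ≡ x → ⊥
       even-return h back′ = step-fpf h (walk h)
         (sym (trans (sym (reflect h back′ h (≤-trans (m≤m+n h h) (n≤1+n _)))) (cong walk (middle h))))
       not-back-first : ∀ t → (b : Bool) → isEven t ≡ b → walk (suc t) ≡ x → (∀ s → s < suc t → hits s ≡ false) → ⊥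
       not-back-first t false odd back′ least′ = odd-return t odd back′ least′
       not-back-first t true even back′ least′ with even-half t even
       ... | h , eq = even-return h (subst (λ t → walk (suc t) ≡ x) eq back′)

module Flags where

  open import Data.Bool using (Bool; true)
  open import Data.Nat using (ℕ; _*_; _≤_)
  open import Data.Nat.Properties using (≤-antisym)
  open import Data.Fin using (Fin; combine; remQuot; _≟_)
  open import Data.Fin.Properties using (combine-remQuot; remQuot-combine)
  open import Data.Product using (Σ; _×_; _,_)
  open import Data.Sum using (inj₁; inj₂)
  open import Relation.Nullary.Decidable using (⌊_⌋)
  open import Relation.Binary.PropositionalEquality
  open import Function using (id)
  open import Data.List using (List; _∷_)
  open import Data.List.Relation.Unary.Any using (here; there)
  open import Data.List.Relation.Unary.All using (All) renaming (lookup to All-lookup)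
  open import Data.List.Membership.Propositional using (_∈_)
  open import Defs using (Flag; anyL; orbits)
  open Counting using (∨-true; ∨-trueʳ; ⌊⌋-sound; ⌊⌋-complete)
  open Classes

  anyL-witness : ∀ {A : Set} (p : A → Bool) xs → anyL p xs ≡ true → Σ A λ x → x ∈ xs × p x ≡ true
  anyL-witness p (x ∷ xs) e with ∨-true (p x) _ e
  ... | inj₁ q = x , here refl , q
  ... | inj₂ q with anyL-witness p xs q
  ... | y , m , r = y , there m , r

  anyL-intro : ∀ {A : Set} (p : A → Bool) xs x → x ∈ xs → p x ≡ true → anyL p xs ≡ true
  anyL-intro p (x ∷ xs) .x (here refl) q rewrite q = refl
  anyL-intro p (y ∷ xs) x  (there m)   q = ∨-trueʳ (p y) (anyL-intro p xs x m q)

  module FlagOrbits (n : ℕ) where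
    Gens : Set
    Gens = List (Flag n → Flag n)

    enc : Flag n → Fin (n * 4)
    enc (e , l) = combine e l

    dec : Fin (n * 4) → Flag n
    dec i = remQuot {n} 4 i

    enc-dec : ∀ i → enc (dec i) ≡ i
    enc-dec i = combine-remQuot {n} 4 i

    dec-enc : ∀ f → dec (enc f) ≡ f
    dec-enc (e , l) = remQuot-combine e l

    enc-injective : ∀ {f g} → enc f ≡ enc g → f ≡ g
    enc-injective {f} {g} e = trans (sym (dec-enc f)) (trans (cong dec e) (dec-enc g))

    moves : Gens → Fin (n * 4) → Fin (n * 4) → Bool
    moves gens i j = anyL (λ σ → ⌊ enc (σ (dec i)) ≟ j ⌋) gens

    Invol : Gens → Set
    Invol gens = All (λ σ → ∀ f → σ (σ f) ≡ f) gens

    moves-witness : ∀ gens i j → moves gens i j ≡ true → Σ (Flag n → Flag n) λ σ → σ ∈ gens × enc (σ (dec i)) ≡ j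
    moves-witness gens i j e with anyL-witness _ gens e
    ... | σ , m , q = σ , m , ⌊⌋-sound (_ ≟ j) q

    moves-intro : ∀ gens σ → σ ∈ gens → ∀ i → moves gens i (enc (σ (dec i))) ≡ true
    moves-intro gens σ m i = anyL-intro _ gens σ m (⌊⌋-complete (_ ≟ _) refl)

    moves-sym : ∀ gens → Invol gens → ∀ i j → moves gens i j ≡ true → moves gens j i ≡ true
    moves-sym gens inv i j e with moves-witness gens i j e
    ... | σ , m , refl = subst (λ k → moves gens (enc (σ (dec i))) k ≡ true)
            (trans (cong enc (trans (cong σ (dec-enc (σ (dec i)))) (All-lookup inv m (dec i)))) (enc-dec i))
            (moves-intro gens σ m (enc (σ (dec i))))

    module Orbit (gens : Gens) = Connectivity (moves gens)

    Same : Gens → Flag n → Flag n → Set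
    Same gens f g = Orbit.conn gens (enc f) (enc g)

    same-step : ∀ gens σ → σ ∈ gens → ∀ f → Same gens f (σ f)
    same-step gens σ m f =
      Orbit.edge-conn gens (subst (λ g → moves gens (enc f) (enc (σ g)) ≡ true) (dec-enc f) (moves-intro gens σ m (enc f)))

    same-refl : ∀ gens f → Same gens f f
    same-refl gens f = Orbit.conn-refl gens (enc f)

    same-trans : ∀ gens {f g h} → Same gens f g → Same gens g h → Same gens f h
    same-trans gens = Orbit.conn-trans gens

    same-sym : ∀ gens → Invol gens → ∀ {f g} → Same gens f g → Same gens g f
    same-sym gens inv = Connectivity.Symmetric.conn-sym (moves gens) (moves-sym gens inv)

    moves-by : (R : Fin (n * 4) → Fin (n * 4) → Set) → ∀ gens → All (λ σ → ∀ f → R (enc f) (enc (σ f))) gens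
      → ∀ i j → moves gens i j ≡ true → R i j
    moves-by R gens h i j e with moves-witness gens i j e
    ... | σ , m , refl = subst (λ k → R k (enc (σ (dec i)))) (enc-dec i) (All-lookup h m (dec i))

    same-transport : ∀ gens₁ gens₂ (ψ : Flag n → Flag n)
      → All (λ σ → ∀ f → Same gens₂ (ψ f) (ψ (σ f))) gens₁
      → ∀ {f g} → Same gens₁ f g → Same gens₂ (ψ f) (ψ g)
    same-transport gens₁ gens₂ ψ h {f} {g} c =
      subst₂ (λ a b → Same gens₂ a b) (cong ψ (dec-enc f)) (cong ψ (dec-enc g))
        (transport (moves gens₁) (moves gens₂) (λ i → enc (ψ (dec i))) edge c)
      where
      edge : ∀ i j → moves gens₁ i j ≡ true → Orbit.conn gens₂ (enc (ψ (dec i))) (enc (ψ (dec j)))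
      edge i j e with moves-witness gens₁ i j e
      ... | σ , m , refl = subst (λ g → Same gens₂ (ψ (dec i)) (ψ g)) (sym (dec-enc (σ (dec i)))) (All-lookup h m (dec i))

    orbits-≤ : ∀ gens₁ gens₂ → Invol gens₁ → Invol gens₂ → (ψ : Flag n → Flag n) → (∀ f → ψ (ψ f) ≡ f)
      → All (λ σ → ∀ f → Same gens₂ (ψ f) (ψ (σ f))) gens₁
      → orbits n gens₂ ≤ orbits n gens₁
    orbits-≤ gens₁ gens₂ inv₁ inv₂ ψ ψ-invol h =
      Compare.fewer-classes (moves gens₁) (moves gens₂) (moves-sym gens₁ inv₁) (moves-sym gens₂ inv₂)
        (λ i → enc (ψ (dec i))) reflect
      where
      back : ∀ i → enc (ψ (ψ (dec i))) ≡ i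
      back i = trans (cong enc (ψ-invol (dec i))) (enc-dec i)
      reflect : ∀ i j → Orbit.conn gens₁ (enc (ψ (dec i))) (enc (ψ (dec j))) → Orbit.conn gens₂ i j
      reflect i j c = subst₂ (Orbit.conn gens₂) (back i) (back j) (same-transport gens₁ gens₂ ψ h c)

    orbits-≡ : ∀ gens₁ gens₂ → Invol gens₁ → Invol gens₂ → (ψ : Flag n → Flag n) → (∀ f → ψ (ψ f) ≡ f)
      → All (λ σ → ∀ f → Same gens₂ (ψ f) (ψ (σ f))) gens₁
      → All (λ σ → ∀ f → Same gens₁ (ψ f) (ψ (σ f))) gens₂
      → orbits n gens₁ ≡ orbits n gens₂
    orbits-≡ gens₁ gens₂ inv₁ inv₂ ψ ψ-invol h₁ h₂ =
      ≤-antisym (orbits-≤ gens₂ gens₁ inv₂ inv₁ ψ ψ-invol h₂) (orbits-≤ gens₁ gens₂ inv₁ inv₂ ψ ψ-invol h₁)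

    conjugates : ∀ gens (ψ σ σ′ : Flag n → Flag n) → σ′ ∈ gens → (∀ f → ψ (σ f) ≡ σ′ (ψ f))
      → ∀ f → Same gens (ψ f) (ψ (σ f))
    conjugates gens ψ σ σ′ m eq f = subst (Same gens (ψ f)) (sym (eq f)) (same-step gens σ′ m (ψ f))

    Refines : Gens → Gens → Set
    Refines gens₁ gens₂ = All (λ σ → ∀ f → Same gens₂ f (σ f)) gens₁

    refines-conn : ∀ gens₁ gens₂ → Refines gens₁ gens₂ → ∀ i j → Orbit.conn gens₁ i j → Orbit.conn gens₂ i j
    refines-conn gens₁ gens₂ h i j c = transport (moves gens₁) (moves gens₂) id (moves-by (Orbit.conn gens₂) gens₁ h) c

    refines-≤ : ∀ gens₁ gens₂ → Invol gens₁ → Invol gens₂ → Refines gens₁ gens₂ → orbits n gens₂ ≤ orbits n gens₁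
    refines-≤ gens₁ gens₂ inv₁ inv₂ h = orbits-≤ gens₁ gens₂ inv₁ inv₂ id (λ _ → refl) h

    refines-≡ : ∀ gens₁ gens₂ → Invol gens₁ → Invol gens₂ → Refines gens₁ gens₂ → Refines gens₂ gens₁
      → orbits n gens₁ ≡ orbits n gens₂
    refines-≡ gens₁ gens₂ inv₁ inv₂ h₁ h₂ =
      ≤-antisym (refines-≤ gens₂ gens₁ inv₂ inv₁ h₂) (refines-≤ gens₁ gens₂ inv₁ inv₂ h₁)

    trivial-step : ∀ gens (σ : Flag n → Flag n) → (∀ f → σ f ≡ f) → ∀ f → Same gens f (σ f)
    trivial-step gens σ eq f = subst (Same gens f) (sym (eq f)) (same-refl gens f)

module Subsets where

  open import Data.Bool using (true; false; not)
  open import Data.Nat using (zero; suc)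
  open import Data.Nat.Properties using (suc-injective)
  open import Data.Fin using (Fin; zero; suc)
  import Data.Fin.Properties as Fin
  open import Data.Product using (Σ; _,_)
  open import Relation.Binary.PropositionalEquality
  open import Data.Vec using ([]; _∷_; lookup; _[_]≔_)
  open import Data.Vec.Properties using (lookup-map; lookup∘update; lookup∘update′; lookup-replicate)
  open import Data.Fin.Subset using (Subset; ∣_∣; ∁; ⊤; ⊥)

  subset-ext : ∀ {n} (A B : Subset n) → (∀ e → lookup A e ≡ lookup B e) → A ≡ B
  subset-ext [] [] h = refl
  subset-ext (x ∷ A) (y ∷ B) h = cong₂ _∷_ (h zero) (subset-ext A B (λ e → h (suc e)))

  lookup-∁ : ∀ {n} (A : Subset n) e → lookup (∁ A) e ≡ not (lookup A e)
  lookup-∁ A e = lookup-map e not A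

  lookup-⊥ : ∀ {n} (e : Fin n) → lookup (⊥ {n}) e ≡ false
  lookup-⊥ e = lookup-replicate e false

  record EdgeStep {n} (A B : Subset n) : Set where
    field
      edge      : Fin n
      outside-A : lookup A edge ≡ false
      inside-B  : lookup B edge ≡ true
      elsewhere : ∀ e → e ≢ edge → lookup B e ≡ lookup A e

  step-size : ∀ {n} {A B : Subset n} → EdgeStep A B → ∣ B ∣ ≡ suc ∣ A ∣
  step-size {A = A} {B} st = one-more A B edge outside-A inside-B elsewhere
    where
    open EdgeStep st
    one-more : ∀ {n} (A B : Subset n) e → lookup A e ≡ false → lookup B e ≡ true
      → (∀ e′ → e′ ≢ e → lookup B e′ ≡ lookup A e′) → ∣ B ∣ ≡ suc ∣ A ∣
    one-more (false ∷ A) (true ∷ B) zero refl refl same =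
      cong (λ X → suc ∣ X ∣) (subset-ext B A (λ e → same (suc e) (λ ())))
    one-more (a ∷ A) (b ∷ B) (suc e) out in′ same with same zero (λ ())
    ... | refl with a
    ...   | true  = cong suc (one-more A B e out in′ (λ e′ ne → same (suc e′) (λ q → ne (Fin.suc-injective q))))
    ...   | false = one-more A B e out in′ (λ e′ ne → same (suc e′) (λ q → ne (Fin.suc-injective q)))

  size-zero : ∀ {n} (A : Subset n) → ∣ A ∣ ≡ 0 → A ≡ ⊥
  size-zero [] _ = refl
  size-zero (false ∷ A) p = cong (false ∷_) (size-zero A p)

  size-suc : ∀ {n} (A : Subset n) m → ∣ A ∣ ≡ suc m → Σ (Fin n) λ e → lookup A e ≡ true
  size-suc (true ∷ A) m p = zero , refl
  size-suc (false ∷ A) m p with size-suc A m p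
  ... | e , q = suc e , q

  add-edge-induction : ∀ {n} (P : Subset n → Set) → P ⊥ → (∀ A B → EdgeStep A B → P A → P B) → ∀ A → P A
  add-edge-induction {n} P base step A = by-size ∣ A ∣ A refl
    where
    by-size : ∀ m A → ∣ A ∣ ≡ m → P A
    by-size zero A p = subst P (sym (size-zero A p)) base
    by-size (suc m) A p with size-suc A m p
    ... | e , e∈A = step A′ A st (by-size m A′ (suc-injective (trans (sym (step-size st)) p)))
      where
      A′ : Subset n
      A′ = A [ e ]≔ false
      st : EdgeStep A′ A
      st = record { edge = e ; outside-A = lookup∘update e A false ; inside-B = e∈A
                  ; elsewhere = λ e′ ne → sym (lookup∘update′ ne A false) }

  remove-edge-induction : ∀ {n} (P : Subset n → Set) → P ⊤ → (∀ A B → EdgeStep A B → P B → P A) → ∀ A → P A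
  remove-edge-induction {n} P base step A = by-missing ∣ ∁ A ∣ A refl
    where
    not-false : ∀ b → not b ≡ true → b ≡ false
    not-false false _ = refl
    not-true : ∀ b → not b ≡ false → b ≡ true
    not-true true _ = refl
    by-missing : ∀ m A → ∣ ∁ A ∣ ≡ m → P A
    by-missing zero A p = subst P full base
      where
      full : ⊤ ≡ A
      full = subset-ext ⊤ A (λ e → trans (lookup-replicate e true) (sym (not-true (lookup A e)
               (trans (sym (lookup-∁ A e)) (trans (cong (λ X → lookup X e) (size-zero (∁ A) p)) (lookup-⊥ e))))))
    by-missing (suc m) A p with size-suc (∁ A) m p
    ... | e , e∉A = step A B st (by-missing m B (suc-injective (trans (sym missing) p)))
      where
      B : Subset n
      B = A [ e ]≔ true
      st : EdgeStep A B
      st = record { edge = e ; outside-A = not-false _ (trans (sym (lookup-∁ A e)) e∉A) ; inside-B = lookup∘update e A true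
                  ; elsewhere = λ e′ ne → lookup∘update′ ne A true }
      missing : ∣ ∁ A ∣ ≡ suc ∣ ∁ B ∣
      missing = step-size {A = ∁ B} {∁ A} (record
        { edge = e
        ; outside-A = trans (lookup-∁ B e) (cong not (EdgeStep.inside-B st))
        ; inside-B = e∉A
        ; elsewhere = λ e′ ne → trans (lookup-∁ A e′) (trans (cong not (sym (EdgeStep.elsewhere st e′ ne))) (sym (lookup-∁ B e′))) })

module Ribbon where

  open import Data.Bool using (true; false; if_then_else_)
  open import Data.Nat using (ℕ; zero; suc; _+_; _*_; _≤_; _<_; s≤s)
  open import Data.Nat.Properties
    using (≤-refl; ≤-trans; ≤-reflexive; ≤-pred; m≤n⇒m≤1+n; +-mono-≤; +-monoˡ-≤; +-monoʳ-≤; *-monoʳ-≤;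
           +-comm; +-assoc; *-distribˡ-+; module ≤-Reasoning)
  open import Data.Fin using (Fin; zero; suc; _≟_)
  open import Data.Product using (_×_; _,_; proj₁; proj₂)
  open import Data.Sum using (_⊎_; inj₁; inj₂)
  open import Data.Empty using (⊥; ⊥-elim)
  open import Relation.Nullary using (¬_; yes; no)
  open import Relation.Nullary.Decidable using (⌊_⌋)
  open import Relation.Binary.PropositionalEquality
  open import Function using (id)
  open import Data.List using (List; []; _∷_)
  open import Data.List.Relation.Unary.Any using (here; there)
  open import Data.List.Relation.Unary.All using ([]; _∷_)
  open import Data.List.Membership.Propositional using (_∈_)
  open import Data.Vec using (lookup)
  open import Data.Vec.Properties using (lookup-replicate)
  open import Data.Fin.Subset using (Subset; ⊤)
  open import Defs
  open Classes
  open Counting using (true≢false; ⌊⌋-complete)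
  open Walks using (isEven; module AlternatingWalk)
  open Flags
  open Subsets using (EdgeStep; module EdgeStep)

  τ0L-invol : ∀ l → τ0L (τ0L l) ≡ l
  τ0L-invol zero = refl
  τ0L-invol (suc zero) = refl
  τ0L-invol (suc (suc zero)) = refl
  τ0L-invol (suc (suc (suc zero))) = refl

  τ2L-invol : ∀ l → τ2L (τ2L l) ≡ l
  τ2L-invol zero = refl
  τ2L-invol (suc zero) = refl
  τ2L-invol (suc (suc zero)) = refl
  τ2L-invol (suc (suc (suc zero))) = refl

  τ0L-fpf : ∀ l → τ0L l ≢ l
  τ0L-fpf zero ()
  τ0L-fpf (suc zero) ()
  τ0L-fpf (suc (suc zero)) ()
  τ0L-fpf (suc (suc (suc zero))) ()

  τ2L-fpf : ∀ l → τ2L l ≢ l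
  τ2L-fpf zero ()
  τ2L-fpf (suc zero) ()
  τ2L-fpf (suc (suc zero)) ()
  τ2L-fpf (suc (suc (suc zero))) ()

  πL-τ0L : ∀ l → πL (τ0L l) ≡ τ2L (πL l)
  πL-τ0L zero = refl
  πL-τ0L (suc zero) = refl
  πL-τ0L (suc (suc zero)) = refl
  πL-τ0L (suc (suc (suc zero))) = refl

  πL-τ2L : ∀ l → πL (τ2L l) ≡ τ0L (πL l)
  πL-τ2L zero = refl
  πL-τ2L (suc zero) = refl
  πL-τ2L (suc (suc zero)) = refl
  πL-τ2L (suc (suc (suc zero))) = refl

  πF-invol : ∀ {n} (f : Flag n) → πF (πF f) ≡ f
  πF-invol (e , l) = cong (e ,_) (πL-invol l)

  lookup-⊤ : ∀ {n} (e : Fin n) → lookup (⊤ {n}) e ≡ true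
  lookup-⊤ e = lookup-replicate e true

  module RibbonOrbits (G : RibbonGraph) where
    n : ℕ
    n = nE G
    open FlagOrbits n public

    Sub : Set
    Sub = Subset n

    vertGens : Gens
    vertGens = τ1 G ∷ τ2 ∷ []

    compGens : Sub → Gens
    compGens A = τ1 G ∷ τ2 ∷ τ0-in G A ∷ []

    bdryGens : Sub → Gens
    bdryGens A = τ1 G ∷ τ0-sub G A ∷ []

    gen₀ : ∀ {A : Set} {x : A} {xs : List A} → x ∈ x ∷ xs
    gen₀ = here refl
    gen₁ : ∀ {A : Set} {x y : A} {xs : List A} → y ∈ x ∷ y ∷ xs
    gen₁ = there (here refl)
    gen₂ : ∀ {A : Set} {x y z : A} {xs : List A} → z ∈ x ∷ y ∷ z ∷ xs
    gen₂ = there (there (here refl))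

    membership : ∀ {P : Set} (A : Sub) e → (lookup A e ≡ true → P) → (lookup A e ≡ false → P) → P
    membership {P} A e inside outside = by-value (lookup A e) refl
      where
      by-value : ∀ b → lookup A e ≡ b → P
      by-value true  p = inside p
      by-value false p = outside p

    τ0-in-on : ∀ A e l → lookup A e ≡ true → τ0-in G A (e , l) ≡ (e , τ0L l)
    τ0-in-on A e l p = cong (λ b → if b then (e , τ0L l) else (e , l)) p
    τ0-in-off : ∀ A e l → lookup A e ≡ false → τ0-in G A (e , l) ≡ (e , l)
    τ0-in-off A e l p = cong (λ b → if b then (e , τ0L l) else (e , l)) p
    τ0-sub-on : ∀ A e l → lookup A e ≡ true → τ0-sub G A (e , l) ≡ (e , τ0L l)
    τ0-sub-on A e l p = cong (λ b → if b then (e , τ0L l) else (e , τ2L l)) p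
    τ0-sub-off : ∀ A e l → lookup A e ≡ false → τ0-sub G A (e , l) ≡ (e , τ2L l)
    τ0-sub-off A e l p = cong (λ b → if b then (e , τ0L l) else (e , τ2L l)) p

    τ2-invol : ∀ (f : Flag n) → τ2 (τ2 f) ≡ f
    τ2-invol (e , l) = cong (e ,_) (τ2L-invol l)

    τ0-in-invol : ∀ A f → τ0-in G A (τ0-in G A f) ≡ f
    τ0-in-invol A (e , l) = membership A e
      (λ p → trans (cong (τ0-in G A) (τ0-in-on A e l p)) (trans (τ0-in-on A e (τ0L l) p) (cong (e ,_) (τ0L-invol l))))
      (λ p → trans (cong (τ0-in G A) (τ0-in-off A e l p)) (τ0-in-off A e l p))

    τ0-sub-invol : ∀ A f → τ0-sub G A (τ0-sub G A f) ≡ f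
    τ0-sub-invol A (e , l) = membership A e
      (λ p → trans (cong (τ0-sub G A) (τ0-sub-on A e l p)) (trans (τ0-sub-on A e (τ0L l) p) (cong (e ,_) (τ0L-invol l))))
      (λ p → trans (cong (τ0-sub G A) (τ0-sub-off A e l p)) (trans (τ0-sub-off A e (τ2L l) p) (cong (e ,_) (τ2L-invol l))))

    τ0-sub-fpf : ∀ A f → τ0-sub G A f ≢ f
    τ0-sub-fpf A (e , l) eq = membership A e
      (λ p → τ0L-fpf l (cong proj₂ (trans (sym (τ0-sub-on A e l p)) eq)))
      (λ p → τ2L-fpf l (cong proj₂ (trans (sym (τ0-sub-off A e l p)) eq)))

    vertGens-invol : Invol vertGens
    vertGens-invol = τ1-invol G ∷ τ2-invol ∷ []

    compGens-invol : ∀ A → Invol (compGens A)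
    compGens-invol A = τ1-invol G ∷ τ2-invol ∷ τ0-in-invol A ∷ []

    bdryGens-invol : ∀ A → Invol (bdryGens A)
    bdryGens-invol A = τ1-invol G ∷ τ0-sub-invol A ∷ []

    τ0-sub-in-comp : ∀ A f → Same (compGens A) f (τ0-sub G A f)
    τ0-sub-in-comp A (e , l) = membership A e
      (λ p → subst (Same (compGens A) (e , l)) (trans (τ0-in-on A e l p) (sym (τ0-sub-on A e l p)))
               (same-step (compGens A) (τ0-in G A) gen₂ (e , l)))
      (λ p → subst (Same (compGens A) (e , l)) (sym (τ0-sub-off A e l p)) (same-step (compGens A) τ2 gen₁ (e , l)))

    bdry-refines-comp : ∀ A → Refines (bdryGens A) (compGens A)
    bdry-refines-comp A = same-step (compGens A) (τ1 G) gen₀ ∷ τ0-sub-in-comp A ∷ []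

    comp-refines : ∀ A B → (∀ e → lookup A e ≡ true → lookup B e ≡ true) → Refines (compGens A) (compGens B)
    comp-refines A B A⊆B = same-step (compGens B) (τ1 G) gen₀ ∷ same-step (compGens B) τ2 gen₁ ∷ along-A ∷ []
      where
      along-A : ∀ f → Same (compGens B) f (τ0-in G A f)
      along-A (e , l) = membership A e
        (λ p → subst (Same (compGens B) (e , l)) (trans (τ0-in-on B e l (A⊆B e p)) (sym (τ0-in-on A e l p)))
                 (same-step (compGens B) (τ0-in G B) gen₂ (e , l)))
        (λ p → subst (Same (compGens B) (e , l)) (sym (τ0-in-off A e l p)) (same-refl (compGens B) (e , l)))

    comps-mono : ∀ A B → (∀ e → lookup A e ≡ true → lookup B e ≡ true) → orbits n (compGens B) ≤ orbits n (compGens A)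
    comps-mono A B A⊆B = refines-≤ (compGens A) (compGens B) (compGens-invol A) (compGens-invol B) (comp-refines A B A⊆B)

    comps-empty : ∀ A → (∀ e → lookup A e ≡ false) → orbits n (compGens A) ≡ orbits n vertGens
    comps-empty A none = refines-≡ (compGens A) vertGens (compGens-invol A) vertGens-invol
      (same-step vertGens (τ1 G) gen₀ ∷ same-step vertGens τ2 gen₁
        ∷ trivial-step vertGens (τ0-in G A) (λ { (e , l) → τ0-in-off A e l (none e) }) ∷ [])
      (same-step (compGens A) (τ1 G) gen₀ ∷ same-step (compGens A) τ2 gen₁ ∷ [])

    bdry-empty : ∀ A → (∀ e → lookup A e ≡ false) → orbits n (bdryGens A) ≡ orbits n vertGens
    bdry-empty A none = refines-≡ (bdryGens A) vertGens (bdryGens-invol A) vertGens-invol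
      (same-step vertGens (τ1 G) gen₀
        ∷ conjugates vertGens id (τ0-sub G A) τ2 gen₁ (λ { (e , l) → τ0-sub-off A e l (none e) }) ∷ [])
      (same-step (bdryGens A) (τ1 G) gen₀
        ∷ conjugates (bdryGens A) id τ2 (τ0-sub G A) gen₁ (λ { (e , l) → sym (τ0-sub-off A e l (none e)) }) ∷ [])

    l0 l1 l2 l3 : Fin 4
    l0 = zero
    l1 = suc zero
    l2 = suc (suc zero)
    l3 = suc (suc (suc zero))

    module AddOneEdge {A B : Sub} (step : EdgeStep A B) where
      open EdgeStep step renaming (edge to e; outside-A to e∉A; inside-B to e∈B)

      is-e : ∀ e′ → (e′ ≡ e) ⊎ (e′ ≢ e)
      is-e e′ with e′ ≟ e
      ... | yes p = inj₁ p
      ... | no ¬p = inj₂ ¬p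

      τ0-in-elsewhere : ∀ e′ l → e′ ≢ e → τ0-in G B (e′ , l) ≡ τ0-in G A (e′ , l)
      τ0-in-elsewhere e′ l e′≢e = cong (λ b → if b then (e′ , τ0L l) else (e′ , l)) (elsewhere e′ e′≢e)

      τ0-sub-elsewhere : ∀ e′ l → e′ ≢ e → τ0-sub G A (e′ , l) ≡ τ0-sub G B (e′ , l)
      τ0-sub-elsewhere e′ l e′≢e = cong (λ b → if b then (e′ , τ0L l) else (e′ , τ2L l)) (sym (elsewhere e′ e′≢e))

      comps-decrease-≤1 : orbits n (compGens A) ≤ orbits n (compGens B) + 1
      comps-decrease-≤1 = Join.at-most-one-more (moves-by Join.Joined (compGens B)
        ((λ f → inj₁ (same-step (compGens A) (τ1 G) gen₀ f)) ∷ (λ f → inj₁ (same-step (compGens A) τ2 gen₁ f)) ∷ along-B ∷ []))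
        where
        module Join = Compare.AddEdge (moves (compGens A)) (moves (compGens B))
          (moves-sym (compGens A) (compGens-invol A)) (moves-sym (compGens B) (compGens-invol B)) (enc (e , l0)) (enc (e , l2))
        stay : ∀ f → Same (compGens A) f f
        stay = same-refl (compGens A)
        side : ∀ l → Same (compGens A) (e , l) (e , τ2L l)
        side l = same-step (compGens A) τ2 gen₁ (e , l)
        across-e : ∀ l → Join.Joined (enc (e , l)) (enc (e , τ0L l))
        across-e zero = inj₂ (inj₁ (stay _ , stay _))
        across-e (suc zero) = inj₂ (inj₁ (side l1 , side l3))
        across-e (suc (suc zero)) = inj₂ (inj₂ (stay _ , stay _))
        across-e (suc (suc (suc zero))) = inj₂ (inj₂ (side l3 , side l1))
        along-B : ∀ f → Join.Joined (enc f) (enc (τ0-in G B f))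
        along-B (e′ , l) with is-e e′
        ... | inj₁ refl = subst (λ g → Join.Joined (enc (e , l)) (enc g)) (sym (τ0-in-on B e l e∈B)) (across-e l)
        ... | inj₂ e′≢e = inj₁ (subst (Same (compGens A) (e′ , l)) (sym (τ0-in-elsewhere e′ l e′≢e))
                                 (same-step (compGens A) (τ0-in G A) gen₂ (e′ , l)))

      nonbridge-comps : Same (compGens A) (e , l0) (e , l2) → orbits n (compGens A) ≤ orbits n (compGens B)
      nonbridge-comps joined = refines-≤ (compGens B) (compGens A) (compGens-invol B) (compGens-invol A)
        (same-step (compGens A) (τ1 G) gen₀ ∷ same-step (compGens A) τ2 gen₁ ∷ along-B ∷ [])
        where
        sym-A : ∀ {f g} → Same (compGens A) f g → Same (compGens A) g f
        sym-A = same-sym (compGens A) (compGens-invol A)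
        _then_ : ∀ {f g h} → Same (compGens A) f g → Same (compGens A) g h → Same (compGens A) f h
        _then_ = same-trans (compGens A)
        side : ∀ l → Same (compGens A) (e , l) (e , τ2L l)
        side l = same-step (compGens A) τ2 gen₁ (e , l)
        across-e : ∀ l → Same (compGens A) (e , l) (e , τ0L l)
        across-e zero = joined
        across-e (suc zero) = side l1 then (joined then side l2)
        across-e (suc (suc zero)) = sym-A joined
        across-e (suc (suc (suc zero))) = side l3 then (sym-A joined then side l0)
        along-B : ∀ f → Same (compGens A) f (τ0-in G B f)
        along-B (e′ , l) with is-e e′
        ... | inj₁ refl = subst (Same (compGens A) (e , l)) (sym (τ0-in-on B e l e∈B)) (across-e l)
        ... | inj₂ e′≢e = subst (Same (compGens A) (e′ , l)) (sym (τ0-in-elsewhere e′ l e′≢e))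
                           (same-step (compGens A) (τ0-in G A) gen₂ (e′ , l))

      -- Boundary components.  `cross-e` crosses e (like τ0) and fixes all other
      -- flags; gluing it to the boundary of A gives an intermediate partition
      -- refined both by the boundary of A and (up to one merge) by that of B.
      cross-e : Flag n → Flag n
      cross-e (e′ , l) = if ⌊ e′ ≟ e ⌋ then (e′ , τ0L l) else (e′ , l)

      cross-e-on : ∀ l → cross-e (e , l) ≡ (e , τ0L l)
      cross-e-on l = cong (λ b → if b then (e , τ0L l) else (e , l)) (⌊⌋-complete (e ≟ e) refl)

      cross-e-off : ∀ e′ l → e′ ≢ e → cross-e (e′ , l) ≡ (e′ , l)
      cross-e-off e′ l e′≢e with e′ ≟ e
      ... | yes p = ⊥-elim (e′≢e p)
      ... | no _  = refl

      cross-e-invol : ∀ f → cross-e (cross-e f) ≡ f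
      cross-e-invol (e′ , l) with is-e e′
      ... | inj₁ refl = trans (cong cross-e (cross-e-on l)) (trans (cross-e-on (τ0L l)) (cong (e ,_) (τ0L-invol l)))
      ... | inj₂ e′≢e = trans (cong cross-e (cross-e-off e′ l e′≢e)) (cross-e-off e′ l e′≢e)

      gluedGens : Gens
      gluedGens = τ1 G ∷ τ0-sub G A ∷ cross-e ∷ []

      gluedGens-invol : Invol gluedGens
      gluedGens-invol = τ1-invol G ∷ τ0-sub-invol A ∷ cross-e-invol ∷ []

      across-e-in-B : ∀ l → Same (bdryGens B) (e , l) (e , τ0L l)
      across-e-in-B l = subst (Same (bdryGens B) (e , l)) (τ0-sub-on B e l e∈B) (same-step (bdryGens B) (τ0-sub G B) gen₁ (e , l))

      sub-B-elsewhere : ∀ e′ l → e′ ≢ e → Same (bdryGens B) (e′ , l) (τ0-sub G A (e′ , l))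
      sub-B-elsewhere e′ l e′≢e = subst (Same (bdryGens B) (e′ , l)) (sym (τ0-sub-elsewhere e′ l e′≢e))
                                    (same-step (bdryGens B) (τ0-sub G B) gen₁ (e′ , l))

      glued-≤-bdry-A : orbits n gluedGens ≤ orbits n (bdryGens A)
      glued-≤-bdry-A = refines-≤ (bdryGens A) gluedGens (bdryGens-invol A) gluedGens-invol
        (same-step gluedGens (τ1 G) gen₀ ∷ same-step gluedGens (τ0-sub G A) gen₁ ∷ [])

      -- Up to the single new pair (e,l0)–(e,l1), B-boundaries are unions of glued classes.
      bdry-B-≤-glued+1 : orbits n (bdryGens B) ≤ orbits n gluedGens + 1
      bdry-B-≤-glued+1 = Join.at-most-one-more (moves-by Join.Joined gluedGens
        ((λ f → inj₁ (same-step (bdryGens B) (τ1 G) gen₀ f)) ∷ along-sub-A ∷ along-cross ∷ []))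
        where
        module Join = Compare.AddEdge (moves (bdryGens B)) (moves gluedGens)
          (moves-sym (bdryGens B) (bdryGens-invol B)) (moves-sym gluedGens gluedGens-invol) (enc (e , l0)) (enc (e , l1))
        stay : ∀ f → Same (bdryGens B) f f
        stay = same-refl (bdryGens B)
        sides-of-e : ∀ l → Join.Joined (enc (e , l)) (enc (e , τ2L l))
        sides-of-e zero = inj₂ (inj₁ (stay _ , stay _))
        sides-of-e (suc zero) = inj₂ (inj₂ (stay _ , stay _))
        sides-of-e (suc (suc zero)) = inj₂ (inj₁ (across-e-in-B l2 , across-e-in-B l3))
        sides-of-e (suc (suc (suc zero))) = inj₂ (inj₂ (across-e-in-B l3 , across-e-in-B l2))
        along-sub-A : ∀ f → Join.Joined (enc f) (enc (τ0-sub G A f))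
        along-sub-A (e′ , l) with is-e e′
        ... | inj₁ refl = subst (λ g → Join.Joined (enc (e , l)) (enc g)) (sym (τ0-sub-off A e l e∉A)) (sides-of-e l)
        ... | inj₂ e′≢e = inj₁ (sub-B-elsewhere e′ l e′≢e)
        along-cross : ∀ f → Join.Joined (enc f) (enc (cross-e f))
        along-cross (e′ , l) with is-e e′
        ... | inj₁ refl = inj₁ (subst (Same (bdryGens B) (e , l)) (sym (cross-e-on l)) (across-e-in-B l))
        ... | inj₂ e′≢e = inj₁ (subst (Same (bdryGens B) (e′ , l)) (sym (cross-e-off e′ l e′≢e)) (stay _))

      bdry-increase-≤1 : orbits n (bdryGens B) ≤ orbits n (bdryGens A) + 1
      bdry-increase-≤1 = ≤-trans bdry-B-≤-glued+1 (+-monoˡ-≤ 1 glued-≤-bdry-A)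

      -- If the ends of e lie in different components of A (e is a bridge of
      -- B), the two sides l0, l1 of one end lie on a common boundary component
      -- of B: walk around the boundary of A from (e,l0); it stays in the
      -- component of (e,l0), so it meets e only at (e,l0) and (e,l1), and
      -- until it reaches (e,l1) every step is also a boundary step of B.
      module Bridge (apart : ¬ Same (compGens A) (e , l0) (e , l2)) where
        α β : Fin (n * 4) → Fin (n * 4)
        α y = enc (τ1 G (dec y))
        β y = enc (τ0-sub G A (dec y))

        encoded-invol : (σ : Flag n → Flag n) → (∀ f → σ (σ f) ≡ f) → ∀ y → enc (σ (dec (enc (σ (dec y))))) ≡ y
        encoded-invol σ h y = trans (cong (λ g → enc (σ g)) (dec-enc (σ (dec y)))) (trans (cong enc (h (dec y))) (enc-dec y))

        encoded-fpf : (σ : Flag n → Flag n) → (∀ f → σ f ≢ f) → ∀ y → enc (σ (dec y)) ≢ y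
        encoded-fpf σ h y eq = h (dec y) (enc-injective (trans eq (sym (enc-dec y))))

        x : Fin (n * 4)
        x = enc (e , l0)

        module W = AlternatingWalk α β (encoded-invol (τ1 G) (τ1-invol G)) (encoded-invol (τ0-sub G A) (τ0-sub-invol A))
                     (encoded-fpf (τ1 G) (τ1-fpf G)) (encoded-fpf (τ0-sub G A) (τ0-sub-fpf A)) x

        βx : β x ≡ enc (e , l1)
        βx = cong enc (trans (cong (τ0-sub G A) (dec-enc (e , l0))) (τ0-sub-off A e l0 e∉A))

        α-step : ∀ gens → τ1 G ∈ gens → ∀ y → Orbit.conn gens y (α y)
        α-step gens m y = Orbit.edge-conn gens (moves-intro gens (τ1 G) m y)

        β-step-comp : ∀ y → Orbit.conn (compGens A) y (β y)
        β-step-comp y = subst (λ k → Orbit.conn (compGens A) k (β y)) (enc-dec y) (τ0-sub-in-comp A (dec y))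

        β-step-bdry : ∀ y → y ≢ x → y ≢ β x → Orbit.conn (compGens A) x y → Orbit.conn (bdryGens B) y (β y)
        β-step-bdry y y≢x y≢βx in-comp = at (proj₁ (dec y)) (proj₂ (dec y)) refl
          where
          on-e : ∀ l → y ≡ enc (e , l) → ⊥
          on-e zero q = y≢x q
          on-e (suc zero) q = y≢βx (trans q (sym βx))
          on-e (suc (suc zero)) q = apart (subst (Orbit.conn (compGens A) x) q in-comp)
          on-e (suc (suc (suc zero))) q =
            apart (Orbit.conn-trans (compGens A) (subst (Orbit.conn (compGens A) x) q in-comp) (same-step (compGens A) τ2 gen₁ (e , l3)))
          at : ∀ e′ l → dec y ≡ (e′ , l) → Orbit.conn (bdryGens B) y (β y)
          at e′ l d with is-e e′
          ... | inj₁ refl = ⊥-elim (on-e l (trans (sym (enc-dec y)) (cong enc d)))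
          ... | inj₂ e′≢e = subst₂ (Orbit.conn (bdryGens B)) (trans (cong enc (sym d)) (enc-dec y))
                              (cong enc (cong (τ0-sub G A) (sym d))) (sub-B-elsewhere e′ l e′≢e)

        module Before (t : ℕ) (avoids : ∀ s → s < t → (W.walk (suc s) ≢ x) × (W.walk (suc s) ≢ β x)) where
          Reached : Fin (n * 4) → Set
          Reached z = Orbit.conn (bdryGens B) x z × Orbit.conn (compGens A) x z

          avoids-at : ∀ s → isEven s ≡ false → s ≤ t → (W.walk s ≢ x) × (W.walk s ≢ β x)
          avoids-at (suc s) _ le = avoids s le

          reached : ∀ s → s ≤ suc t → Reached (W.walk s)
          reached zero _ = Orbit.conn-refl (bdryGens B) x , Orbit.conn-refl (compGens A) x
          reached (suc s) le = next (isEven s) refl (reached s (m≤n⇒m≤1+n (≤-pred le)))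
            where
            y : Fin (n * 4)
            y = W.walk s
            next : ∀ b → isEven s ≡ b → Reached y → Reached (W.walk (suc s))
            next true p (in-bdry , in-comp) = subst Reached (sym (W.step-even s y p))
              (Orbit.conn-trans (bdryGens B) in-bdry (α-step (bdryGens B) gen₀ y) , Orbit.conn-trans (compGens A) in-comp (α-step (compGens A) gen₀ y))
            next false p (in-bdry , in-comp) with avoids-at s p (≤-pred le)
            ... | y≢x , y≢βx = subst Reached (sym (W.step-odd s y p))
              (Orbit.conn-trans (bdryGens B) in-bdry (β-step-bdry y y≢x y≢βx in-comp) , Orbit.conn-trans (compGens A) in-comp (β-step-comp y))

        sides-joined : Same (bdryGens B) (e , l0) (e , l1)
        sides-joined with W.reaches-βx
        ... | t , at-βx , avoids = subst (Orbit.conn (bdryGens B) x) (trans at-βx βx) (proj₁ (Before.reached t avoids (suc t) ≤-refl))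

        bdry-B-≤-glued : orbits n (bdryGens B) ≤ orbits n gluedGens
        bdry-B-≤-glued = refines-≤ gluedGens (bdryGens B) gluedGens-invol (bdryGens-invol B)
          (same-step (bdryGens B) (τ1 G) gen₀ ∷ along-sub-A ∷ along-cross ∷ [])
          where
          sym-B : ∀ {f g} → Same (bdryGens B) f g → Same (bdryGens B) g f
          sym-B = same-sym (bdryGens B) (bdryGens-invol B)
          _then_ : ∀ {f g h} → Same (bdryGens B) f g → Same (bdryGens B) g h → Same (bdryGens B) f h
          _then_ = same-trans (bdryGens B)
          sides-of-e : ∀ l → Same (bdryGens B) (e , l) (e , τ2L l)
          sides-of-e zero = sides-joined
          sides-of-e (suc zero) = sym-B sides-joined
          sides-of-e (suc (suc zero)) = across-e-in-B l2 then (sides-joined then across-e-in-B l1)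
          sides-of-e (suc (suc (suc zero))) = across-e-in-B l3 then (sym-B sides-joined then across-e-in-B l0)
          along-sub-A : ∀ f → Same (bdryGens B) f (τ0-sub G A f)
          along-sub-A (e′ , l) with is-e e′
          ... | inj₁ refl = subst (Same (bdryGens B) (e , l)) (sym (τ0-sub-off A e l e∉A)) (sides-of-e l)
          ... | inj₂ e′≢e = sub-B-elsewhere e′ l e′≢e
          along-cross : ∀ f → Same (bdryGens B) f (cross-e f)
          along-cross (e′ , l) with is-e e′
          ... | inj₁ refl = subst (Same (bdryGens B) (e , l)) (sym (cross-e-on l)) (across-e-in-B l)
          ... | inj₂ e′≢e = subst (Same (bdryGens B) (e′ , l)) (sym (cross-e-off e′ l e′≢e)) (same-refl (bdryGens B) _)

        glued-<-bdry-A : suc (orbits n gluedGens) ≤ orbits n (bdryGens A)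
        glued-<-bdry-A = Compare.Coarser.merge (moves (bdryGens A)) (moves gluedGens)
          (moves-sym (bdryGens A) (bdryGens-invol A)) (moves-sym gluedGens gluedGens-invol)
          (refines-conn (bdryGens A) gluedGens (same-step gluedGens (τ1 G) gen₀ ∷ same-step gluedGens (τ0-sub G A) gen₁ ∷ []))
          (enc (e , l0)) (enc (e , l2))
          (subst (Same gluedGens (e , l0)) (cross-e-on l0) (same-step gluedGens cross-e gen₂ (e , l0)))
          (λ c → apart (refines-conn (bdryGens A) (compGens A) (bdry-refines-comp A) _ _ c))

        bridge-bdry : suc (orbits n (bdryGens B)) ≤ orbits n (bdryGens A)
        bridge-bdry = ≤-trans (s≤s bdry-B-≤-glued) glued-<-bdry-A

      ends-joined? : Same (compGens A) (e , l0) (e , l2) ⊎ ¬ Same (compGens A) (e , l0) (e , l2)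
      ends-joined? = by-value (reach (moves (compGens A)) (n * 4) (enc (e , l0)) (enc (e , l2))) refl
        where
        by-value : ∀ b → reach (moves (compGens A)) (n * 4) (enc (e , l0)) (enc (e , l2)) ≡ b
          → Same (compGens A) (e , l0) (e , l2) ⊎ ¬ Same (compGens A) (e , l0) (e , l2)
        by-value true  r = inj₁ r
        by-value false r = inj₂ λ c → true≢false (trans (sym c) r)

      -- Euler genus does not decrease when e is added:
      --   b(B) + 2 k(A) ≤ b(A) + 1 + 2 k(B).
      euler-step : orbits n (bdryGens B) + 2 * orbits n (compGens A) ≤ orbits n (bdryGens A) + 1 + 2 * orbits n (compGens B)
      euler-step with ends-joined?
      ... | inj₁ joined = +-mono-≤ bdry-increase-≤1 (*-monoʳ-≤ 2 (nonbridge-comps joined))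
      ... | inj₂ apart  = begin
          bB + 2 * kA           ≤⟨ +-monoʳ-≤ bB (*-monoʳ-≤ 2 (≤-trans comps-decrease-≤1 (≤-reflexive (+-comm kB 1)))) ⟩
          bB + 2 * (1 + kB)     ≡⟨ cong (bB +_) (*-distribˡ-+ 2 1 kB) ⟩
          bB + (2 + 2 * kB)     ≡⟨ sym (+-assoc bB 2 (2 * kB)) ⟩
          (bB + 2) + 2 * kB     ≡⟨ cong (_+ 2 * kB) (+-comm bB 2) ⟩
          suc (suc bB) + 2 * kB ≤⟨ +-monoˡ-≤ (2 * kB) (≤-trans (s≤s (Bridge.bridge-bdry apart)) (≤-reflexive (+-comm 1 bA))) ⟩
          bA + 1 + 2 * kB       ∎
        where
        open ≤-Reasoning
        bA bB kA kB : ℕ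
        bA = orbits n (bdryGens A)
        bB = orbits n (bdryGens B)
        kA = orbits n (compGens A)
        kB = orbits n (compGens B)

module Duality where

  open import Data.Bool using (not)
  open import Data.Product using (_,_)
  open import Relation.Binary.PropositionalEquality
  open import Data.List using ([]; _∷_)
  open import Data.List.Relation.Unary.All using ([]; _∷_)
  open import Data.Vec using (lookup)
  open import Data.Fin.Subset using (⊤)
  open import Defs
  open Flags
  open Ribbon

  -- The relabelling πF exchanges τ0 and
  -- τ2 and conjugates τ1 of G* to τ1 of G, so it maps
  --   vertices of G*            to faces (boundary components of E) of G,
  --   components of (V, E) in G* to components of (V, E) in G,
  --   boundary of (V, A^c) in G* to boundary of (V, A) in G.
  module DualOrbits (G : RibbonGraph) where
    module RG = RibbonOrbits G
    module RD = RibbonOrbits (dual G)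
    open FlagOrbits (nE G)

    τ1-dual : ∀ f → πF (τ1 (dual G) f) ≡ τ1 G (πF f)
    τ1-dual f = πF-invol _

    τ1-primal : ∀ f → πF (τ1 G f) ≡ τ1 (dual G) (πF f)
    τ1-primal f = cong (λ g → πF (τ1 G g)) (sym (πF-invol f))

    dual-bdry : ∀ A B → (∀ e → lookup B e ≡ not (lookup A e)) → orbits (nE G) (RD.bdryGens B) ≡ orbits (nE G) (RG.bdryGens A)
    dual-bdry A B complement = orbits-≡ (RD.bdryGens B) (RG.bdryGens A) (RD.bdryGens-invol B) (RG.bdryGens-invol A) πF πF-invol
        (conjugates (RG.bdryGens A) πF (τ1 (dual G)) (τ1 G) RG.gen₀ τ1-dual
          ∷ conjugates (RG.bdryGens A) πF (τ0-sub (dual G) B) (τ0-sub G A) RG.gen₁ to-primal ∷ [])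
        (conjugates (RD.bdryGens B) πF (τ1 G) (τ1 (dual G)) RG.gen₀ τ1-primal
          ∷ conjugates (RD.bdryGens B) πF (τ0-sub G A) (τ0-sub (dual G) B) RG.gen₁ to-dual ∷ [])
      where
      to-primal : ∀ f → πF (τ0-sub (dual G) B f) ≡ τ0-sub G A (πF f)
      to-primal (e , l) = RG.membership A e
        (λ a → trans (cong πF (RD.τ0-sub-off B e l (trans (complement e) (cong not a))))
                 (trans (cong (e ,_) (πL-τ2L l)) (sym (RG.τ0-sub-on A e (πL l) a))))
        (λ a → trans (cong πF (RD.τ0-sub-on B e l (trans (complement e) (cong not a))))
                 (trans (cong (e ,_) (πL-τ0L l)) (sym (RG.τ0-sub-off A e (πL l) a))))
      to-dual : ∀ f → πF (τ0-sub G A f) ≡ τ0-sub (dual G) B (πF f)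
      to-dual (e , l) = RG.membership A e
        (λ a → trans (cong πF (RG.τ0-sub-on A e l a))
                 (trans (cong (e ,_) (πL-τ0L l)) (sym (RD.τ0-sub-off B e (πL l) (trans (complement e) (cong not a))))))
        (λ a → trans (cong πF (RG.τ0-sub-off A e l a))
                 (trans (cong (e ,_) (πL-τ2L l)) (sym (RD.τ0-sub-on B e (πL l) (trans (complement e) (cong not a))))))

    dual-comps : orbits (nE G) (RD.compGens ⊤) ≡ orbits (nE G) (RG.compGens ⊤)
    dual-comps = orbits-≡ (RD.compGens ⊤) (RG.compGens ⊤) (RD.compGens-invol ⊤) (RG.compGens-invol ⊤) πF πF-invol
        (conjugates (RG.compGens ⊤) πF (τ1 (dual G)) (τ1 G) RG.gen₀ τ1-dual
          ∷ conjugates (RG.compGens ⊤) πF τ2 (τ0-in G ⊤) RG.gen₂ (τ2-to-τ0 G)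
          ∷ conjugates (RG.compGens ⊤) πF (τ0-in (dual G) ⊤) τ2 RG.gen₁ (τ0-to-τ2 (dual G)) ∷ [])
        (conjugates (RD.compGens ⊤) πF (τ1 G) (τ1 (dual G)) RG.gen₀ τ1-primal
          ∷ conjugates (RD.compGens ⊤) πF τ2 (τ0-in (dual G) ⊤) RG.gen₂ (τ2-to-τ0 (dual G))
          ∷ conjugates (RD.compGens ⊤) πF (τ0-in G ⊤) τ2 RG.gen₁ (τ0-to-τ2 G) ∷ [])
      where
      τ2-to-τ0 : ∀ H f → πF (τ2 f) ≡ τ0-in H ⊤ (πF f)
      τ2-to-τ0 H (e , l) = trans (cong (e ,_) (πL-τ2L l)) (sym (RibbonOrbits.τ0-in-on H ⊤ e (πL l) (lookup-⊤ e)))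
      τ0-to-τ2 : ∀ H f → πF (τ0-in H ⊤ f) ≡ τ2 (πF f)
      τ0-to-τ2 H (e , l) = trans (cong πF (RibbonOrbits.τ0-in-on H ⊤ e l (lookup-⊤ e))) (cong (e ,_) (πL-τ0L l))

    dual-verts : orbits (nE G) RD.vertGens ≡ orbits (nE G) (RG.bdryGens ⊤)
    dual-verts = orbits-≡ RD.vertGens (RG.bdryGens ⊤) RD.vertGens-invol (RG.bdryGens-invol ⊤) πF πF-invol
        (conjugates (RG.bdryGens ⊤) πF (τ1 (dual G)) (τ1 G) RG.gen₀ τ1-dual
          ∷ conjugates (RG.bdryGens ⊤) πF τ2 (τ0-sub G ⊤) RG.gen₁ τ2-to-τ0 ∷ [])
        (conjugates RD.vertGens πF (τ1 G) (τ1 (dual G)) RG.gen₀ τ1-primal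
          ∷ conjugates RD.vertGens πF (τ0-sub G ⊤) τ2 RG.gen₁ τ0-to-τ2 ∷ [])
      where
      τ2-to-τ0 : ∀ f → πF (τ2 f) ≡ τ0-sub G ⊤ (πF f)
      τ2-to-τ0 (e , l) = trans (cong (e ,_) (πL-τ2L l)) (sym (RG.τ0-sub-on ⊤ e (πL l) (lookup-⊤ e)))
      τ0-to-τ2 : ∀ f → πF (τ0-sub G ⊤ f) ≡ τ2 (πF f)
      τ0-to-τ2 (e , l) = trans (cong πF (RG.τ0-sub-on ⊤ e l (lookup-⊤ e))) (cong (e ,_) (πL-τ0L l))

module Arithmetic where

  open import Data.Nat using (ℕ; _+_; _*_; _∸_; _≤_; ⌊_/2⌋)
  open import Data.Nat.Properties
    using (≤-trans; ≤-reflexive; m≤m+n; m≤n+m; m≤n⇒∃[o]m+o≡n; +-mono-≤; +-monoˡ-≤; +-cancelʳ-≡; +-cancelʳ-≤;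
           +-cancelˡ-≤; m+n∸m≡n; m+n∸n≡m; m∸n+n≡m; ∸-monoˡ-≤; ⌊n/2⌋-mono; n≡⌊n+n/2⌋; module ≤-Reasoning)
  open import Data.Nat.Tactic.RingSolver using (solve)
  open import Data.List using (_∷_; [])
  open import Data.Product using (_×_; _,_)
  open import Relation.Binary.PropositionalEquality

  ∸-exact : ∀ m n {o} → n + o ≡ m → m ∸ n ≡ o
  ∸-exact .(n + o) n {o} refl = m+n∸m≡n n o

  half-mono : ∀ {m n} → m + m ≤ n + n → m ≤ n
  half-mono {m} {n} le = subst₂ _≤_ (sym (n≡⌊n+n/2⌋ m)) (sym (n≡⌊n+n/2⌋ n)) (⌊n/2⌋-mono le)

  half-double : ∀ w → ⌊ w + w /2⌋ ≡ w
  half-double w = sym (n≡⌊n+n/2⌋ w)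

  eliminate : ∀ L R {s t} → s ≡ t → L + s ≡ R + t → L ≡ R
  eliminate L R refl e = +-cancelʳ-≡ _ L R e

  add-and-cancel : ∀ {x y x′ y′ p q c} → x ≤ y → x′ ≤ y′ → x + x′ ≡ p + c → y + y′ ≡ q + c → p ≤ q
  add-and-cancel {c = c} le le′ e₁ e₂ = +-cancelʳ-≤ c _ _ (subst₂ _≤_ e₁ e₂ (+-mono-≤ le le′))

  module Counts (V C B a : ℕ) (C≤V : C ≤ V) (V≤C+a : V ≤ C + a) (euler : V + B ≤ 2 * C + a) where
    rank genus : ℕ
    rank  = V ∸ C
    genus = (2 * C + a) ∸ (V + B)

    rank-exact : rank + C ≡ V
    rank-exact = m∸n+n≡m C≤V

    rank-≤-size : rank ≤ a
    rank-≤-size = ≤-trans (∸-monoˡ-≤ C V≤C+a) (≤-reflexive (m+n∸m≡n C a))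

    genus-exact : genus + (V + B) ≡ 2 * C + a
    genus-exact = m∸n+n≡m euler

    euler-rank : genus + B + 2 * rank ≡ V + a
    euler-rank = rank-form {genus} {rank} genus-exact rank-exact
      where
      rank-form : ∀ {g r} → g + (V + B) ≡ 2 * C + a → r + C ≡ V → g + B + 2 * r ≡ V + a
      rank-form {g} {r} eg er = eliminate _ _ (cong₂ _+_ (sym eg) (cong (2 *_) (sym er))) (solve (V ∷ C ∷ B ∷ a ∷ r ∷ g ∷ []))

  -- Isolated vertices add the same number I to the counts of vertices,
  -- components and boundary components; the basic inequalities survive.
  module ShiftByIsolated (I : ℕ) where
    open ≤-Reasoning

    shift-rank : ∀ {v k a} → v ≤ k + a → v + I ≤ (k + I) + a
    shift-rank {v} {k} {a} le = begin
      v + I        ≤⟨ +-monoˡ-≤ I le ⟩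
      k + a + I    ≡⟨ solve (k ∷ a ∷ I ∷ []) ⟩
      (k + I) + a  ∎

    shift-euler : ∀ {v b k a} → v + b ≤ 2 * k + a → (v + I) + (b + I) ≤ 2 * (k + I) + a
    shift-euler {v} {b} {k} {a} le = begin
      (v + I) + (b + I)    ≡⟨ solve (v ∷ b ∷ I ∷ []) ⟩
      v + b + (I + I)      ≤⟨ +-monoˡ-≤ (I + I) le ⟩
      2 * k + a + (I + I)  ≡⟨ solve (k ∷ a ∷ I ∷ []) ⟩
      2 * (k + I) + a      ∎

    shift-genus : ∀ {kA a bE kE n bA} → 2 * kA + a + bE ≤ 2 * kE + n + bA
      → 2 * (kA + I) + a + (bE + I) ≤ 2 * (kE + I) + n + (bA + I)
    shift-genus {kA} {a} {bE} {kE} {n} {bA} le = begin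
      2 * (kA + I) + a + (bE + I)    ≡⟨ solve (kA ∷ a ∷ bE ∷ I ∷ []) ⟩
      2 * kA + a + bE + (I + I + I)  ≤⟨ +-monoˡ-≤ (I + I + I) le ⟩
      2 * kE + n + bA + (I + I + I)  ≡⟨ solve (kE ∷ n ∷ bA ∷ I ∷ []) ⟩
      2 * (kE + I) + n + (bA + I)    ∎

  genus-mono : ∀ {V CA BA a CE BE n gA gE} →
    gA + (V + BA) ≡ 2 * CA + a → gE + (V + BE) ≡ 2 * CE + n →
    2 * CA + a + BE ≤ 2 * CE + n + BA → gA ≤ gE
  genus-mono {V} {CA} {BA} {a} {CE} {BE} {n} {gA} {gE} eA eE le =
    +-cancelʳ-≤ (V + BA + BE) gA gE (begin
      gA + (V + BA + BE)      ≡⟨ solve (gA ∷ V ∷ BA ∷ BE ∷ []) ⟩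
      gA + (V + BA) + BE      ≡⟨ cong (_+ BE) eA ⟩
      2 * CA + a + BE         ≤⟨ le ⟩
      2 * CE + n + BA         ≡⟨ cong (_+ BA) (sym eE) ⟩
      gE + (V + BE) + BA      ≡⟨ solve (gE ∷ V ∷ BE ∷ BA ∷ []) ⟩
      gE + (V + BA + BE)      ∎)
    where open ≤-Reasoning

  -- Coordinates for `exponent-identities` below: every inequality is replaced
  -- by its slack, so that
  --   a = ρX + nX,  c = ρY + m,  ρE = ρX + p,  ρE* = ρY + y,  γE = γY + δ,
  --   V = ρE + K,   F = ρE* + K.
  -- In them the three Euler relations yield two doubling identities, which
  -- make the halvings on the right-hand side exact.
  module EulerCoordinates (ρX nX ρY m y p K bX γX γY δ : ℕ)
    (eulerX : γX + bX + 2 * ρX ≡ (ρX + p + K) + (ρX + nX))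
    (eulerE : (γY + δ) + (ρY + y + K) + 2 * (ρX + p) ≡ (ρX + p + K) + ((ρX + nX) + (ρY + m)))
    (eulerY : γY + bX + 2 * ρY ≡ (ρY + y + K) + (ρY + m)) where

    doubling-y : δ + γX + (y + y) ≡ nX + nX
    doubling-y = eliminate _ _ (cong₂ _+_ (cong₂ _+_ (sym eulerX) (sym eulerE)) eulerY)
      (solve (ρX ∷ nX ∷ ρY ∷ m ∷ y ∷ p ∷ K ∷ bX ∷ γX ∷ γY ∷ δ ∷ []))

    doubling-z : (γY + δ) + γY + (p + p) ≡ γX + (m + m)
    doubling-z = eliminate _ _ (cong₂ _+_ (cong₂ _+_ (sym eulerE) eulerX) (sym eulerY))
      (solve (ρX ∷ nX ∷ ρY ∷ m ∷ y ∷ p ∷ K ∷ bX ∷ γX ∷ γY ∷ δ ∷ []))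

  -- The y-exponent identity in coordinates: both sides evaluate to y.
  y-exponent-value : ∀ ρX ρY y w γX γY δ → δ + γX ≡ w + w →
    (ρX + (y + w)) ∸ (((ρX + (y + w)) + ρY) ∸ (ρY + y)) ≡ ((ρX + (y + w)) ∸ ρX) ∸ ⌊ (γY + δ + γX) ∸ γY /2⌋
  y-exponent-value ρX ρY y w γX γY δ halves = trans lhs (sym rhs)
    where
    open ≡-Reasoning
    bond-rank : ((ρX + (y + w)) + ρY) ∸ (ρY + y) ≡ ρX + w
    bond-rank = ∸-exact ((ρX + (y + w)) + ρY) (ρY + y) (solve (ρX ∷ ρY ∷ y ∷ w ∷ []))
    genus-gap : (γY + δ + γX) ∸ γY ≡ δ + γX
    genus-gap = ∸-exact (γY + δ + γX) γY (solve (γY ∷ δ ∷ γX ∷ []))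
    lhs : (ρX + (y + w)) ∸ (((ρX + (y + w)) + ρY) ∸ (ρY + y)) ≡ y
    lhs = begin
      (ρX + (y + w)) ∸ (((ρX + (y + w)) + ρY) ∸ (ρY + y)) ≡⟨ cong ((ρX + (y + w)) ∸_) bond-rank ⟩
      (ρX + (y + w)) ∸ (ρX + w)                           ≡⟨ ∸-exact (ρX + (y + w)) (ρX + w) (solve (ρX ∷ y ∷ w ∷ [])) ⟩
      y                                                   ∎
    rhs : ((ρX + (y + w)) ∸ ρX) ∸ ⌊ (γY + δ + γX) ∸ γY /2⌋ ≡ y
    rhs = begin
      ((ρX + (y + w)) ∸ ρX) ∸ ⌊ (γY + δ + γX) ∸ γY /2⌋ ≡⟨ cong₂ (λ u v → u ∸ ⌊ v /2⌋) (m+n∸m≡n ρX (y + w)) genus-gap ⟩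
      (y + w) ∸ ⌊ δ + γX /2⌋                           ≡⟨ cong (λ v → (y + w) ∸ ⌊ v /2⌋) halves ⟩
      (y + w) ∸ ⌊ w + w /2⌋                            ≡⟨ cong ((y + w) ∸_) (half-double w) ⟩
      (y + w) ∸ w                                      ≡⟨ m+n∸n≡m y w ⟩
      y                                                ∎

  -- The z-exponent identity in coordinates: both sides evaluate to z.
  z-exponent-value : ∀ ρX ρY y w p z γX γE γY → γE + γY ≡ γX + (z + z) →
    (((ρX + (y + w)) + (ρY + (p + z))) + 0) ∸ (ρY + y) ∸ (((ρX + (y + w)) + ρY) ∸ (ρY + y)) ∸ ((ρX + p) ∸ ρX)
      ≡ ⌊ (γE + γY) ∸ γX /2⌋
  z-exponent-value ρX ρY y w p z γX γE γY halves = trans lhs (sym rhs)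
    where
    open ≡-Reasoning
    total-bond-rank : (((ρX + (y + w)) + (ρY + (p + z))) + 0) ∸ (ρY + y) ≡ (ρX + w) + (p + z)
    total-bond-rank = ∸-exact (((ρX + (y + w)) + (ρY + (p + z))) + 0) (ρY + y) (solve (ρX ∷ ρY ∷ y ∷ w ∷ p ∷ z ∷ []))
    bond-rank : ((ρX + (y + w)) + ρY) ∸ (ρY + y) ≡ ρX + w
    bond-rank = ∸-exact ((ρX + (y + w)) + ρY) (ρY + y) (solve (ρX ∷ ρY ∷ y ∷ w ∷ []))
    genus-gap : (γE + γY) ∸ γX ≡ z + z
    genus-gap = ∸-exact (γE + γY) γX (sym halves)
    lhs : (((ρX + (y + w)) + (ρY + (p + z))) + 0) ∸ (ρY + y) ∸ (((ρX + (y + w)) + ρY) ∸ (ρY + y)) ∸ ((ρX + p) ∸ ρX) ≡ z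
    lhs = begin
      (((ρX + (y + w)) + (ρY + (p + z))) + 0) ∸ (ρY + y) ∸ (((ρX + (y + w)) + ρY) ∸ (ρY + y)) ∸ ((ρX + p) ∸ ρX)
        ≡⟨ cong₂ (λ u v → u ∸ v ∸ ((ρX + p) ∸ ρX)) total-bond-rank bond-rank ⟩
      ((ρX + w) + (p + z)) ∸ (ρX + w) ∸ ((ρX + p) ∸ ρX) ≡⟨ cong₂ _∸_ (m+n∸m≡n (ρX + w) (p + z)) (m+n∸m≡n ρX p) ⟩
      (p + z) ∸ p                                      ≡⟨ m+n∸m≡n p z ⟩
      z                                                ∎
    rhs : ⌊ (γE + γY) ∸ γX /2⌋ ≡ z
    rhs = trans (cong ⌊_/2⌋ genus-gap) (half-double z)

  -- The exponent identities behind Proposition 3.3, for abstract numbers: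
  -- a = |X|, c = |X^c|, n = |E|; ρX, ρE are ranks of X and E in G, ρY, ρE*
  -- ranks of X^c and E in G*, ρ∅* the rank of ∅ in G*; γX, γE, γY are the
  -- Euler genera of X in G, of G, and of X^c in G*; V, F, K count vertices,
  -- faces and components of G, and bX the boundary components of X.
  -- In the coordinates above, both y-exponents equal y = ρE* − ρY and both
  -- z-exponents equal z = m − p.
  exponent-identities : ∀ {a c n V F K bX ρX ρE ρY ρE* ρ∅* γX γE γY : ℕ} →
    a + c ≡ n →
    ρE + K ≡ V → ρE* + K ≡ F → ρ∅* ≡ 0 →
    ρX ≤ a → ρY ≤ c → ρX ≤ ρE → ρY ≤ ρE* →
    γX + bX + 2 * ρX ≡ V + a → γE + F + 2 * ρE ≡ V + n → γY + bX + 2 * ρY ≡ F + c →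
    γX ≤ γE → γY ≤ γE →
    (a ∸ ((a + ρY) ∸ ρE*) ≡ (a ∸ ρX) ∸ ⌊ (γE + γX) ∸ γY /2⌋) ×
    (((n + ρ∅*) ∸ ρE*) ∸ ((a + ρY) ∸ ρE*) ∸ (ρE ∸ ρX) ≡ ⌊ (γE + γY) ∸ γX /2⌋)
  exponent-identities {K = K} {bX} {ρX} {ρY = ρY} {γX = γX} {γY = γY}
    refl refl refl refl ρX≤a ρY≤c ρX≤ρE ρY≤ρE* eulerX eulerE eulerY γX≤γE γY≤γE
    with m≤n⇒∃[o]m+o≡n ρX≤a | m≤n⇒∃[o]m+o≡n ρY≤c | m≤n⇒∃[o]m+o≡n ρX≤ρE
       | m≤n⇒∃[o]m+o≡n ρY≤ρE* | m≤n⇒∃[o]m+o≡n γY≤γE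
  ... | nX , refl | m , refl | p , refl | y , refl | δ , refl
    with m≤n⇒∃[o]m+o≡n y≤nX | m≤n⇒∃[o]m+o≡n p≤m
    where
    module E = EulerCoordinates ρX nX ρY m y p K bX γX γY δ eulerX eulerE eulerY
    y≤nX : y ≤ nX
    y≤nX = half-mono (≤-trans (m≤n+m (y + y) (δ + γX)) (≤-reflexive E.doubling-y))
    p≤m : p ≤ m
    p≤m = half-mono (+-cancelˡ-≤ γX (p + p) (m + m)
            (≤-trans (+-monoˡ-≤ (p + p) (≤-trans γX≤γE (m≤m+n (γY + δ) γY))) (≤-reflexive E.doubling-z)))
  ... | w , refl | z , refl =
    y-exponent-value ρX ρY y w γX γY δ halves-y , z-exponent-value ρX ρY y w p z γX (γY + δ) γY halves-z
    where
    module E = EulerCoordinates ρX (y + w) ρY (p + z) y p K bX γX γY δ eulerX eulerE eulerY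
    halves-y : δ + γX ≡ w + w
    halves-y = +-cancelʳ-≡ (y + y) (δ + γX) (w + w) (trans E.doubling-y (solve (y ∷ w ∷ [])))
    halves-z : (γY + δ) + γY ≡ γX + (z + z)
    halves-z = +-cancelʳ-≡ (p + p) ((γY + δ) + γY) (γX + (z + z)) (trans E.doubling-z (solve (γX ∷ p ∷ z ∷ [])))

module Bounds where

  open import Data.Nat using (ℕ; suc; _+_; _*_; _≤_)
  open import Data.Nat.Properties using (≤-trans; ≤-reflexive; +-monoˡ-≤; +-assoc; +-identityʳ)
  open import Data.Empty using (⊥-elim)
  open import Relation.Binary.PropositionalEquality
  open import Data.Nat.Tactic.RingSolver using (solve-∀)
  open import Data.Fin.Subset using (∣_∣; ⊤; ⊥)
  open import Data.Fin.Subset.Properties using (∣⊥∣≡0; ∣⊤∣≡n)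
  open import Defs
  open Counting using (true≢false)
  open Subsets
  open Arithmetic using (add-and-cancel)
  open Ribbon

  module OrbitBounds (G : RibbonGraph) where
    open RibbonOrbits G

    v : ℕ
    v = orbits n vertGens

    k b : Sub → ℕ
    k A = orbits n (compGens A)
    b A = orbits n (bdryGens A)

    k⊥≡v : k ⊥ ≡ v
    k⊥≡v = comps-empty ⊥ lookup-⊥

    b⊥≡v : b ⊥ ≡ v
    b⊥≡v = bdry-empty ⊥ lookup-⊥

    -- Edges can only merge vertices into components: c(A) ≤ v.
    comps-≤-verts : ∀ A → k A ≤ v
    comps-≤-verts A = subst (k A ≤_) k⊥≡v (comps-mono ⊥ A (λ e p → ⊥-elim (true≢false (trans (sym p) (lookup-⊥ e)))))

    total-≤-comps : ∀ A → k ⊤ ≤ k A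
    total-≤-comps A = comps-mono A ⊤ (λ e _ → lookup-⊤ e)

    -- Each edge merges at most two components: v ≤ c(A) + |A|.
    verts-≤-comps+size : ∀ A → v ≤ k A + ∣ A ∣
    verts-≤-comps+size = add-edge-induction (λ A → v ≤ k A + ∣ A ∣) base step
      where
      base : v ≤ k ⊥ + ∣ ⊥ {n} ∣
      base = ≤-reflexive (sym (trans (cong₂ _+_ k⊥≡v (∣⊥∣≡0 n)) (+-identityʳ v)))
      step : ∀ A B → EdgeStep A B → v ≤ k A + ∣ A ∣ → v ≤ k B + ∣ B ∣
      step A B st IH = ≤-trans IH (≤-trans (+-monoˡ-≤ ∣ A ∣ (AddOneEdge.comps-decrease-≤1 st))
                         (≤-reflexive (trans (+-assoc (k B) 1 ∣ A ∣) (cong (k B +_) (sym (step-size st))))))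

    -- Non-negativity of the Euler genus: v + f(A) ≤ 2 c(A) + |A|.
    euler-≥ : ∀ A → v + b A ≤ 2 * k A + ∣ A ∣
    euler-≥ = add-edge-induction (λ A → v + b A ≤ 2 * k A + ∣ A ∣) base step
      where
      base : v + b ⊥ ≤ 2 * k ⊥ + ∣ ⊥ {n} ∣
      base = ≤-reflexive (trans (cong (v +_) b⊥≡v) (sym (trans (cong₂ (λ x y → 2 * x + y) k⊥≡v (∣⊥∣≡0 n)) (double v))))
        where
        double : ∀ v → 2 * v + 0 ≡ v + v
        double = solve-∀
      step : ∀ A B → EdgeStep A B → v + b A ≤ 2 * k A + ∣ A ∣ → v + b B ≤ 2 * k B + ∣ B ∣
      step A B st IH = add-and-cancel IH (AddOneEdge.euler-step st) (left v (b A) (b B) (k A))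
        (trans (right (k A) (k B) (b A) ∣ A ∣) (cong (λ s → 2 * k B + s + (b A + 2 * k A)) (sym (step-size st))))
        where
        left : ∀ v bA bB kA → (v + bA) + (bB + 2 * kA) ≡ (v + bB) + (bA + 2 * kA)
        left = solve-∀
        right : ∀ kA kB bA a → (2 * kA + a) + (bA + 1 + 2 * kB) ≡ (2 * kB + suc a) + (bA + 2 * kA)
        right = solve-∀

    -- Monotonicity of the Euler genus: γ(A) ≤ γ(E), in terms of counts.
    counts-genus-mono : ∀ A → 2 * k A + ∣ A ∣ + b ⊤ ≤ 2 * k ⊤ + n + b A
    counts-genus-mono = remove-edge-induction (λ A → 2 * k A + ∣ A ∣ + b ⊤ ≤ 2 * k ⊤ + n + b A) base step
      where
      base : 2 * k ⊤ + ∣ ⊤ {n} ∣ + b ⊤ ≤ 2 * k ⊤ + n + b ⊤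
      base = ≤-reflexive (cong (λ s → 2 * k ⊤ + s + b ⊤) (∣⊤∣≡n n))
      step : ∀ A B → EdgeStep A B → 2 * k B + ∣ B ∣ + b ⊤ ≤ 2 * k ⊤ + n + b B → 2 * k A + ∣ A ∣ + b ⊤ ≤ 2 * k ⊤ + n + b A
      step A B st IH = add-and-cancel IH (AddOneEdge.euler-step st)
        (trans (cong (λ s → 2 * k B + s + b ⊤ + (b B + 2 * k A)) (step-size st)) (left (k A) (k B) (b B) (b ⊤) ∣ A ∣))
        (right (k ⊤) (k B) (b A) (b B) n)
        where
        left : ∀ kA kB bB bE a → (2 * kB + suc a + bE) + (bB + 2 * kA) ≡ (2 * kA + a + bE) + (2 * kB + 1 + bB)
        left = solve-∀
        right : ∀ kE kB bA bB n → (2 * kE + n + bB) + (bA + 1 + 2 * kB) ≡ (2 * kE + n + bA) + (2 * kB + 1 + bB)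
        right = solve-∀

open import Level using (Level)
open import Algebra.Bundles using (CommutativeRing)
open import Data.Bool using (not)
open import Data.Nat using (ℕ; _+_; _*_; _∸_; _≤_; ⌊_/2⌋)
open import Data.Nat.Properties using (≤-trans; ≤-reflexive; +-monoˡ-≤; ∸-monoʳ-≤; n∸n≡0; +-comm; m+[n∸m]≡n)
open import Data.Product using (_×_; _,_; proj₁; proj₂)
open import Relation.Binary.PropositionalEquality
open import Data.List.Properties using (map-cong)
open import Data.Fin.Subset using (Subset; ∣_∣; ∁; ⊤; ⊥)
open import Data.Fin.Subset.Properties using (∣⊤∣≡n; ∣∁p∣≡n∸∣p∣; ∣p∣≤n)
open import Defs
open Arithmetic
open Subsets using (lookup-∁; lookup-⊥)
open Ribbon
open Bounds

module RankGenus (H : RibbonGraph) where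
  open OrbitBounds H
  open RibbonOrbits H using (n; comps-empty)

  I : ℕ
  I = nIso H

  open ShiftByIsolated I

  -- nVert H = v + I, comps H A = k A + I and bdry H A = b A + I.
  module At (A : Subset n) = Counts (nVert H) (comps H A) (bdry H A) ∣ A ∣
    (+-monoˡ-≤ I (comps-≤-verts A))
    (shift-rank {v} {k A} {∣ A ∣} (verts-≤-comps+size A))
    (shift-euler {v} {b A} {k A} {∣ A ∣} (euler-≥ A))

  rank-exact : ∀ A → rk H A + comps H A ≡ nVert H
  rank-exact A = At.rank-exact A

  rank-≤-size : ∀ A → rk H A ≤ ∣ A ∣
  rank-≤-size A = At.rank-≤-size A

  rank-≤-total : ∀ A → rk H A ≤ rk H ⊤
  rank-≤-total A = ∸-monoʳ-≤ (nVert H) (+-monoˡ-≤ I (total-≤-comps A))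

  rank-empty : rk H (∁ ⊤) ≡ 0
  rank-empty = trans (cong (λ c → nVert H ∸ (c + I)) (comps-empty (∁ ⊤) (λ e → trans (lookup-∁ ⊤ e) (cong not (lookup-⊤ e)))))
                     (n∸n≡0 (nVert H))

  euler : ∀ A → eg H A + bdry H A + 2 * rk H A ≡ nVert H + ∣ A ∣
  euler A = At.euler-rank A

  genus-≤-total : ∀ A → eg H A ≤ γ H
  genus-≤-total A =
    genus-mono {nVert H} {comps H A} {bdry H A} {∣ A ∣} {comps H ⊤} {bdry H ⊤} {∣ ⊤ {n} ∣} (At.genus-exact A) (At.genus-exact ⊤)
      (subst (λ m → 2 * comps H A + ∣ A ∣ + bdry H ⊤ ≤ 2 * comps H ⊤ + m + bdry H A) (sym (∣⊤∣≡n n))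
        (shift-genus {k A} {∣ A ∣} {b ⊤} {k ⊤} {n} {b A} (counts-genus-mono A)))

module DualCounts (G : RibbonGraph) where
  open Duality.DualOrbits G
  open RibbonOrbits G using (bdry-empty)

  dual-nVert : nVert (dual G) ≡ bdry G ⊤
  dual-nVert = cong (_+ nIso G) dual-verts

  dual-comps-⊤ : comps (dual G) ⊤ ≡ comps G ⊤
  dual-comps-⊤ = cong (_+ nIso G) dual-comps

  dual-bdry-∁ : ∀ X → bdry (dual G) (∁ X) ≡ bdry G X
  dual-bdry-∁ X = cong (_+ nIso G) (dual-bdry X (∁ X) (lookup-∁ X))

  dual-bdry-⊤ : bdry (dual G) ⊤ ≡ nVert G
  dual-bdry-⊤ = cong (_+ nIso G)
    (trans (dual-bdry ⊥ ⊤ (λ e → trans (lookup-⊤ e) (cong not (sym (lookup-⊥ e))))) (bdry-empty ⊥ lookup-⊥))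

  dual-genus : γ (dual G) ≡ γ G
  dual-genus = cong₂ (λ c w → (2 * c + ∣ ⊤ {nE G} ∣) ∸ w) dual-comps-⊤
                 (trans (cong₂ _+_ dual-nVert dual-bdry-⊤) (+-comm (bdry G ⊤) (nVert G)))

module Exponents (G : RibbonGraph) (X : Subset (nE G)) where
  private
    module RG = RankGenus G
    module RD = RankGenus (dual G)
    open DualCounts G
    n : ℕ
    n = nE G

  size-split : ∣ X ∣ + ∣ ∁ X ∣ ≡ ∣ ⊤ {n} ∣
  size-split = trans (cong (∣ X ∣ +_) (∣∁p∣≡n∸∣p∣ X)) (trans (m+[n∸m]≡n (∣p∣≤n X)) (sym (∣⊤∣≡n n)))

  exponents-agree : (∣ X ∣ ∸ bondRank (dual G) X ≡ nul G X ∸ ⌊ (γ G + eg G X) ∸ eg (dual G) (∁ X) /2⌋)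
       × ((bondRank (dual G) ⊤ ∸ bondRank (dual G) X) ∸ (rk G ⊤ ∸ rk G X) ≡ ⌊ (γ G + eg (dual G) (∁ X)) ∸ eg G X /2⌋)
  exponents-agree = exponent-identities size-split
    (RG.rank-exact ⊤)
    (subst₂ (λ c v → rk (dual G) ⊤ + c ≡ v) dual-comps-⊤ dual-nVert (RD.rank-exact ⊤))
    RD.rank-empty
    (RG.rank-≤-size X) (RD.rank-≤-size (∁ X))
    (RG.rank-≤-total X) (RD.rank-≤-total (∁ X))
    (RG.euler X) (RG.euler ⊤)
    (subst₂ (λ f v → eg (dual G) (∁ X) + f + 2 * rk (dual G) (∁ X) ≡ v + ∣ ∁ X ∣) (dual-bdry-∁ X) dual-nVert (RD.euler (∁ X)))
    (RG.genus-≤-total X)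
    (≤-trans (RD.genus-≤-total (∁ X)) (≤-reflexive dual-genus))

proposition3p3 : {c ℓ : Level} (R : CommutativeRing c ℓ) (G : RibbonGraph)
    → (x y z : CommutativeRing.Carrier R)
    → CommutativeRing._≈_ R (Poly.lasVergnas R G x y z) (Poly.rhs33 R G x y z)
proposition3p3 R G x y z = reflexive (cong sumL (map-cong same-term (allSubsets (nE G))))
  where
  open CommutativeRing R using (1#; reflexive) renaming (_*_ to _·_; _-_ to _−_)
  open Poly R using (pow; sumL)
  same-term : ∀ X → pow (x − 1#) (rk G ⊤ ∸ rk G X)
                    · pow (y − 1#) (∣ X ∣ ∸ bondRank (dual G) X)
                    · pow z ((bondRank (dual G) ⊤ ∸ bondRank (dual G) X) ∸ (rk G ⊤ ∸ rk G X))
                  ≡ pow (x − 1#) (rk G ⊤ ∸ rk G X)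
                    · pow (y − 1#) (nul G X ∸ ⌊ (γ G + eg G X) ∸ eg (dual G) (∁ X) /2⌋)
                    · pow z ⌊ (γ G + eg (dual G) (∁ X)) ∸ eg G X /2⌋
  same-term X = cong₂ (λ u w → pow (x − 1#) (rk G ⊤ ∸ rk G X) · pow (y − 1#) u · pow z w)
                      (proj₁ (Exponents.exponents-agree G X)) (proj₂ (Exponents.exponents-agree G X))
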